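{- For graphic matroids $M$, setting $\Psi_M:=\tilde Z_G(q,t)\in\mathbb{Z}(q,t)$ for any finite graph $G$ with $M(G)\simeq M$ gives a well-defined assignment (that is, $M(G)\simeq M(H)$ implies $\tilde Z_G(q,t)=\tilde Z_H(q,t)$), and this assignment is a Tutte–Grothendieck invariant on the class of graphic matroids.
   Context: For a finite graph $G=(V,E)$ (loops and multiple edges allowed) let $n(G),m(G),c(G)$ be the numbers of vertices, edges and connected components. Let $\Pi_V$ be the set of set partitions of $V$; for $e\in E$, $\pi\in\Pi_V$ write $e\prec\pi$ if some block of $\pi$ contains both ends of $e$, and $\langle G:\pi\rangle:=\#\{e\in E:e\not\prec\pi\}$. Define $Z_G(q,t):=\sum_{\pi\in\Pi_V}q^{\langle G:\pi\rangle}t_{(\#\pi)}$ with $t_{(k)}=t(t-1)\cdots(t-k+1)$. Let $r(G)=n(G)-c(G)$, $s(G)=m(G)-n(G)+c(G)$, and $\tilde Z_G(q,t):=\dfrac{Z_G(q,t)}{t^{c(G)}(1-q)^{r(G)}q^{s(G)}}$. The graphic matroid $M(G)$ has ground set $E$ and rank function $\rho(S)=n(G)-c((V,S))$. A link of a matroid is an element that is neither a loop nor a coloop. For a minor-closed class $\mathfrak{C}$ of matroids, a Tutte–Grothendieck invariant on $\mathfrak{C}$ is an assignment $M\mapsto\Psi_M$ into a fixed commutative ring such that: ($\alpha$) $M\simeq N$ implies $\Psi_M=\Psi_N$; ($\beta$) if $e\in E(M)$ is a link then $\Psi_M=\Psi_{M\setminus e}+\Psi_{M/e}$; ($\gamma$)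 if $M,N$ have disjoint ground sets then $\Psi_{M\oplus N}=\Psi_M\Psi_N$. -}

module Defs where

open import Data.Bool using (Bool; true; false; _∧_; _∨_; not; if_then_else_)
open import Data.Bool.ListAction using (any)
open import Data.Nat as ℕ using (ℕ; zero; suc; _∸_; _<_)
open import Data.Fin as Fin using (Fin; toℕ; inject₁; fromℕ)
open import Data.Fin.Subset using (Subset; ⁅_⁆; ∁; ⊤; _∪_)
open import Data.Integer as ℤ using (ℤ; +_; -_)
open import Data.List as List using (List; []; _∷_; _++_; concatMap; foldr)
open import Data.Vec as Vec using (Vec; lookup; tabulate; countᵇ; allFin; insertAt; _∷ʳ_)
open import Data.Product using (Σ; _×_; _,_; proj₁; proj₂)
open import Relation.Nullary using (¬_; does)
open import Relation.Binary.PropositionalEquality using (_≡_; _≢_)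
open import Function.Bundles using (_↔_; Inverse)

-- Polynomials in ℤ[q,t]: finite formal sums of monomials  a·q^i·t^j,
-- represented by a list of triples (a , i , j).  Two polynomials are
-- equal iff all their coefficients agree.

Poly : Set
Poly = List (ℤ × ℕ × ℕ)

coeff : Poly → ℕ → ℕ → ℤ
coeff [] i j = + 0
coeff ((a , k , l) ∷ p) i j =
  (if does (k ℕ.≟ i) ∧ does (l ℕ.≟ j) then a else + 0) ℤ.+ coeff p i j

_≈P_ : Poly → Poly → Set
p ≈P p' = ∀ i j → coeff p i j ≡ coeff p' i j

infixl 6 _+P_
infixl 7 _*P_

_+P_ : Poly → Poly → Poly
_+P_ = _++_

negP : Poly → Poly
negP = List.map (λ { (a , i , j) → (- a , i , j) })

_*P_ : Poly → Poly → Poly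
p *P p' = concatMap (λ { (a , i , j) →
            List.map (λ { (b , k , l) → (a ℤ.* b , i ℕ.+ k , j ℕ.+ l) }) p' }) p

constP : ℤ → Poly
constP a = (a , 0 , 0) ∷ []

1P : Poly
1P = constP (+ 1)

qP tP : Poly
qP = (+ 1 , 1 , 0) ∷ []
tP = (+ 1 , 0 , 1) ∷ []

_^P_ : Poly → ℕ → Poly
p ^P zero  = 1P
p ^P suc n = p *P (p ^P n)

sumP : List Poly → Poly
sumP = foldr _+P_ []

fallingT : ℕ → Poly
fallingT zero    = 1P
fallingT (suc k) = fallingT k *P (tP +P constP (- (+ k)))

record Frac : Set where
  constructor _/_
  field
    num den : Poly
open Frac public

_≈F_ : Frac → Frac → Set
(a / b) ≈F (c / d) = (a *P d) ≈P (c *P b)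

_+F_ : Frac → Frac → Frac
(a / b) +F (c / d) = ((a *P d) +P (c *P b)) / (b *P d)

_*F_ : Frac → Frac → Frac
(a / b) *F (c / d) = (a *P c) / (b *P d)

-- Finite graphs (loops and multiple edges allowed): vertex set Fin n,
-- edge set Fin m, each edge has a (unordered) pair of ends.

record Graph : Set where
  field
    n m  : ℕ
    ends : Fin m → Fin n × Fin n
open Graph public

_==_ : ∀ {k} → Fin k → Fin k → Bool
u == v = does (u Fin.≟ v)

reach : (G : Graph) → Subset (m G) → ℕ → Fin (n G) → Fin (n G) → Bool
reach G S zero    u v = u == v
reach G S (suc k) u v = reach G S k u v ∨
  any (λ e → lookup S e ∧
      ((reach G S k u (proj₁ (ends G e)) ∧ (proj₂ (ends G e) == v)) ∨
       (reach G S k u (proj₂ (ends G e)) ∧ (proj₁ (ends G e) == v))))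
    (List.allFin (m G))

-- u and v are in the same connected component of (V,S)
-- (walks of length ≤ n(G) suffice)
connected : (G : Graph) → Subset (m G) → Fin (n G) → Fin (n G) → Bool
connected G S = reach G S (n G)

-- number of connected components of (V,S): the number of vertices that
-- are the smallest vertex of their component.
compS : (G : Graph) → Subset (m G) → ℕ
compS G S = countᵇ (λ v → not (any (λ u → does (toℕ u ℕ.<? toℕ v) ∧ connected G S u v)
                                         (List.allFin (n G))))
                   (allFin (n G))

c : Graph → ℕ
c G = compS G ⊤

r s : Graph → ℕ
r G = n G ∸ c G
s G = (m G ℕ.+ c G) ∸ n G

-- Set partitions of Fin n, encoded canonically: a partition with k blocks
-- is a labelling Vec (Fin k) n of the vertices by block labels, where
-- blocks are labelled 0,1,...,k-1 in order of their smallest element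
-- (restricted growth strings).  Π n lists every partition exactly once.

SetPartition : ℕ → Set
SetPartition n = Σ ℕ λ k → Vec (Fin k) n

Π : (n : ℕ) → List (SetPartition n)
Π zero    = (0 , Vec.[]) ∷ []
Π (suc n) = concatMap (λ { (k , v) →
              List.map (λ i → (k , v ∷ʳ i)) (List.allFin k)
              ++ ((suc k , Vec.map inject₁ v ∷ʳ fromℕ k) ∷ []) }) (Π n)

#blocks : ∀ {n} → SetPartition n → ℕ
#blocks = proj₁

cut : (G : Graph) → SetPartition (n G) → ℕ
cut G (k , v) = countᵇ (λ e → not (lookup v (proj₁ (ends G e)) == lookup v (proj₂ (ends G e))))
                       (allFin (m G))

Z : Graph → Poly
Z G = sumP (List.map (λ π → (qP ^P cut G π) *P fallingT (#blocks π)) (Π (n G)))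

Z̃ : Graph → Frac
Z̃ G = Z G / ((tP ^P c G) *P ((1P +P negP qP) ^P r G) *P (qP ^P s G))

-- Matroids on ground set Fin m, given by their rank function.

Matroid : ℕ → Set
Matroid m = Subset m → ℕ

M[_] : (G : Graph) → Matroid (m G)
M[ G ] S = n G ∸ compS G S

image : ∀ {a b} → Fin a ↔ Fin b → Subset a → Subset b
image f S = tabulate (λ j → lookup S (Inverse.from f j))

_≃M_ : ∀ {a b} → Matroid a → Matroid b → Set
_≃M_ {a} {b} M N = Σ (Fin a ↔ Fin b) λ f → ∀ S → N (image f S) ≡ M S

IsGraphic : ∀ {a} → Matroid a → Set
IsGraphic M = Σ Graph λ G → M[ G ] ≃M M

-- deletion and contraction of e; the remaining elements are Fin k
-- (embedded into Fin (suc k) by skipping e).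
_∖ₘ_ : ∀ {k} → Matroid (suc k) → Fin (suc k) → Matroid k
(M ∖ₘ e) S = M (insertAt S e false)

_/ₘ_ : ∀ {k} → Matroid (suc k) → Fin (suc k) → Matroid k
(M /ₘ e) S = M (insertAt S e true) ∸ M ⁅ e ⁆

_⊕_ : ∀ {a b} → Matroid a → Matroid b → Matroid (a ℕ.+ b)
_⊕_ {a} M N S = M (Vec.take a S) ℕ.+ N (Vec.drop a S)

IsLoop : ∀ {k} → Matroid k → Fin k → Set
IsLoop M e = M ⁅ e ⁆ ≡ 0

IsColoop : ∀ {k} → Matroid k → Fin k → Set
IsColoop M e = M (∁ ⁅ e ⁆) < M ⊤

IsLink : ∀ {k} → Matroid k → Fin k → Set
IsLink M e = ¬ IsLoop M e × ¬ IsColoop M e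

{-# OPTIONS --safe #-}
-- Writing 1 = q + (1 - q) for every edge not cut by π expands q^⟨G:π⟩ as the sum of
-- (1 - q)^|A| q^(|E| - |A|) over the edge sets A containing no cut edge, i.e. over the A whose
-- components π coarsens. Summing over π first, the falling factorials t_(#π) of the partitions
-- coarser than a partition into c blocks add up to t^c, so
--   Z_G = Σ_A t^c(A) (1 - q)^|A| q^(|E| - |A|).
-- Since c(A) = c(G) + ρ(E) - ρ(A), both Z_G and the denominator t^c(G) (1 - q)^ρ(E) q^(|E| - ρ(E))
-- of Z̃_G are t^c(G) times an expression in the rank function of M(G) alone, so Z̃_G depends only on
-- M(G). For a link e, splitting the sum on whether e ∈ A writes the numerator as q times that of M∖e
-- plus (1 - q) times that of M/e, while the denominator is q times that of M∖e and also (1 - q) times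
-- that of M/e; numerator and denominator are multiplicative on direct sums. Deleting or contracting an
-- edge and taking disjoint unions realise M∖e, M/e and M ⊕ N by graphs.

module Submission where

open import Defs
open import Algebra.Bundles using (CommutativeRing)
import Algebra.Consequences.Setoid as Consequences
import Algebra.Properties.CommutativeSemigroup as CommSemigroupProperties
import Algebra.Properties.Monoid.Sum as MonoidSum
import Algebra.Properties.CommutativeMonoid.Sum as CommMonoidSum
open import Data.Bool as Bool using (Bool; true; false; _∧_; _∨_; not; if_then_else_)
open import Data.Bool.ListAction using (any)
import Data.Bool.Properties as BoolP
open import Data.Integer as ℤ using (ℤ; 0ℤ; 1ℤ; -_) renaming (_+_ to _+ℤ_; _*_ to _*ℤ_)
import Data.Integer.Properties as ℤP
open import Data.List as List using (List; _++_; concatMap; foldr)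
open List.List
import Data.List.Properties as ListP
open import Data.Nat as ℕ using (ℕ; zero; suc; _∸_; _≤_; _<_; z≤n; s≤s; _≡ᵇ_; _≤ᵇ_; _<ᵇ_)
import Data.Nat.Properties as ℕP
open import Data.Fin.Subset using (Subset; ∣_∣; ⊤; ⊥; ⁅_⁆; ∁; _⊆_)
import Data.Fin.Subset.Properties as FinSubsetP
open FinSubsetP using (∣p∣≤n)
open import Data.Fin as Fin using (Fin; zero; suc; toℕ; inject₁; fromℕ; punchIn; punchOut; _↑ˡ_; _↑ʳ_)
import Data.Fin.Properties as FinP
open import Data.Fin.Permutation using (↔⇒≡)
open import Data.Vec as Vec using (Vec; []; _∷_; lookup; insertAt)
import Data.Vec.Properties as VecP
open import Data.Product as Product using (Σ-syntax; ∃; _×_; _,_; proj₁; proj₂)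
open import Data.Sum using (_⊎_; inj₁; inj₂; [_,_])
open import Data.Empty using (⊥-elim)
open import Function using (_∘_; id)
open import Function.Bundles using (Equivalence; Inverse; _↔_; _⇔_; mk⇔)
open import Function.Construct.Identity using (↔-id)
open import Relation.Nullary using (Dec; ¬_; does; yes; no)
open import Relation.Nullary.Decidable using (dec-true; dec-false; does-⇔; _→-dec_; _×-dec_)
open import Relation.Binary.PropositionalEquality
  using (_≡_; _≢_; refl; sym; trans; cong; cong₂; subst; subst₂; module ≡-Reasoning)
import Relation.Binary.Reasoning.Setoid as SetoidReasoning
open import Tactic.RingSolver using (solve-∀)
open import Tactic.RingSolver.Core.AlmostCommutativeRing using (AlmostCommutativeRing; fromCommutativeRing)
open import Data.Maybe using (nothing)
open import Relation.Binary.Bundles using (Setoid)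
open import Level using (0ℓ)
open import Relation.Binary.Definitions using (Symmetric; Transitive)

module ListSum {c ℓ} (R : CommutativeRing c ℓ) where

  open CommutativeRing R hiding (refl; sym; trans)
  open CommutativeRing R using () renaming (refl to ≈-refl; sym to ≈-sym; trans to ≈-trans)
  open SetoidReasoning setoid
  open CommSemigroupProperties +-commutativeSemigroup using (interchange)

  ∑ : {A : Set} → List A → (A → Carrier) → Carrier
  ∑ xs f = foldr _+_ 0# (List.map f xs)

  ∑-cong : ∀ {A : Set} (xs : List A) {f g : A → Carrier} → (∀ x → f x ≈ g x) → ∑ xs f ≈ ∑ xs g
  ∑-cong []       f≈g = ≈-refl
  ∑-cong (x ∷ xs) f≈g = +-cong (f≈g x) (∑-cong xs f≈g)

  ∑-++ : ∀ {A : Set} (xs ys : List A) f → ∑ (xs ++ ys) f ≈ ∑ xs f + ∑ ys f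
  ∑-++ []       ys f = ≈-sym (+-identityˡ _)
  ∑-++ (x ∷ xs) ys f = ≈-trans (+-congˡ (∑-++ xs ys f)) (≈-sym (+-assoc (f x) _ _))

  ∑-0 : ∀ {A : Set} (xs : List A) → ∑ xs (λ _ → 0#) ≈ 0#
  ∑-0 []       = ≈-refl
  ∑-0 (x ∷ xs) = ≈-trans (+-identityˡ _) (∑-0 xs)

  ∑-distrib-+ : ∀ {A : Set} (xs : List A) f g → ∑ xs (λ x → f x + g x) ≈ ∑ xs f + ∑ xs g
  ∑-distrib-+ []       f g = ≈-sym (+-identityˡ 0#)
  ∑-distrib-+ (x ∷ xs) f g = ≈-trans (+-congˡ (∑-distrib-+ xs f g)) (interchange (f x) (g x) _ _)

  *-distribˡ-∑ : ∀ {A : Set} (xs : List A) a f → a * ∑ xs f ≈ ∑ xs (λ x → a * f x)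
  *-distribˡ-∑ []       a f = zeroʳ a
  *-distribˡ-∑ (x ∷ xs) a f = ≈-trans (distribˡ a (f x) _) (+-congˡ (*-distribˡ-∑ xs a f))

  *-distribʳ-∑ : ∀ {A : Set} (xs : List A) a f → ∑ xs f * a ≈ ∑ xs (λ x → f x * a)
  *-distribʳ-∑ xs a f = ≈-trans (*-comm _ a) (≈-trans (*-distribˡ-∑ xs a f) (∑-cong xs λ x → *-comm a (f x)))

  ∑-map : ∀ {A B : Set} (h : B → A) (xs : List B) f → ∑ (List.map h xs) f ≡ ∑ xs (f ∘ h)
  ∑-map h xs f = cong (foldr _+_ 0#) (sym (ListP.map-∘ xs))

  ∑-concatMap : ∀ {A B : Set} (h : B → List A) (xs : List B) f →
                ∑ (concatMap h xs) f ≈ ∑ xs (λ x → ∑ (h x) f)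
  ∑-concatMap h []       f = ≈-refl
  ∑-concatMap h (x ∷ xs) f = ≈-trans (∑-++ (h x) (concatMap h xs) f) (+-congˡ (∑-concatMap h xs f))

  ∑-comm : ∀ {A B : Set} (xs : List A) (ys : List B) (f : A → B → Carrier) →
           ∑ xs (λ x → ∑ ys (f x)) ≈ ∑ ys (λ y → ∑ xs (λ x → f x y))
  ∑-comm []       ys f = ≈-sym (∑-0 ys)
  ∑-comm (x ∷ xs) ys f = begin
    ∑ ys (f x) + ∑ xs (λ x′ → ∑ ys (f x′))         ≈⟨ +-congˡ (∑-comm xs ys f) ⟩
    ∑ ys (f x) + ∑ ys (λ y → ∑ xs (λ x′ → f x′ y)) ≈⟨ ∑-distrib-+ ys (f x) _ ⟨
    ∑ ys (λ y → f x y + ∑ xs (λ x′ → f x′ y))      ∎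

open import Data.Nat using (_+_)

-- The polynomial ring ℤ[q,t]

Term : Set
Term = ℤ × ℕ × ℕ

termCoeff : Term → ℕ → ℕ → ℤ
termCoeff (a , k , l) i j = if does (k ℕ.≟ i) ∧ does (l ℕ.≟ j) then a else 0ℤ

_·ₜ_ : Term → Term → Term
(a , i , j) ·ₜ (b , k , l) = (a *ℤ b , i + k , j + l)

shiftCoeff : Term → (ℕ → ℕ → ℤ) → ℕ → ℕ → ℤ
shiftCoeff (a , k , l) c i j = if (k ≤ᵇ i) ∧ (l ≤ᵇ j) then a *ℤ c (i ∸ k) (j ∸ l) else 0ℤ

module ℤ∑ = ListSum ℤP.+-*-commutativeRing
open ℤ∑ using () renaming (∑ to ∑ℤ)

coeff-∑ : ∀ p i j → coeff p i j ≡ ∑ℤ p (λ x → termCoeff x i j)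
coeff-∑ []               i j = refl
coeff-∑ ((a , k , l) ∷ p) i j = cong (termCoeff (a , k , l) i j +ℤ_) (coeff-∑ p i j)

coeff-+P : ∀ p p′ i j → coeff (p +P p′) i j ≡ coeff p i j +ℤ coeff p′ i j
coeff-+P []               p′ i j = sym (ℤP.+-identityˡ _)
coeff-+P ((a , k , l) ∷ p) p′ i j =
  trans (cong (termCoeff (a , k , l) i j +ℤ_) (coeff-+P p p′ i j)) (sym (ℤP.+-assoc (termCoeff (a , k , l) i j) _ _))

coeff-negP : ∀ p i j → coeff (negP p) i j ≡ - coeff p i j
coeff-negP []               i j = refl
coeff-negP ((a , k , l) ∷ p) i j = begin
  termCoeff (- a , k , l) i j +ℤ coeff (negP p) i j ≡⟨ cong₂ _+ℤ_ termCoeff-neg (coeff-negP p i j) ⟩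
  - termCoeff (a , k , l) i j +ℤ - coeff p i j      ≡⟨ ℤP.neg-distrib-+ (termCoeff (a , k , l) i j) _ ⟨
  - (termCoeff (a , k , l) i j +ℤ coeff p i j)      ∎
  where
  open ≡-Reasoning
  termCoeff-neg : termCoeff (- a , k , l) i j ≡ - termCoeff (a , k , l) i j
  termCoeff-neg with does (k ℕ.≟ i) ∧ does (l ℕ.≟ j)
  ... | true  = refl
  ... | false = refl

coeff-*P : ∀ p p′ i j → coeff (p *P p′) i j ≡ ∑ℤ p (λ x → ∑ℤ p′ (λ y → termCoeff (x ·ₜ y) i j))
coeff-*P p p′ i j = trans (coeff-∑ (p *P p′) i j)
  (trans (ℤ∑.∑-concatMap _ p _) (ℤ∑.∑-cong p (λ x → ℤ∑.∑-map _ p′ _)))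

+-≡ᵇ : ∀ k k′ i → ((k + k′) ≡ᵇ i) ≡ ((k ≤ᵇ i) ∧ (k′ ≡ᵇ (i ∸ k)))
+-≡ᵇ zero    k′ i       = refl
+-≡ᵇ (suc k) k′ zero    = refl
+-≡ᵇ (suc k) k′ (suc i) = trans (+-≡ᵇ k k′ i) (cong (_∧ (k′ ≡ᵇ (i ∸ k))) (≤ᵇ-suc k i))
  where
  ≤ᵇ-suc : ∀ k i → (k ≤ᵇ i) ≡ (suc k ≤ᵇ suc i)
  ≤ᵇ-suc zero    i       = refl
  ≤ᵇ-suc (suc k) zero    = refl
  ≤ᵇ-suc (suc k) (suc i) = refl

termCoeff-·ₜ : ∀ x y i j → termCoeff (x ·ₜ y) i j ≡ shiftCoeff x (termCoeff y) i j
termCoeff-·ₜ (a , k , l) (b , k′ , l′) i j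
  rewrite +-≡ᵇ k k′ i | +-≡ᵇ l l′ j
  with k ≤ᵇ i | l ≤ᵇ j | k′ ≡ᵇ (i ∸ k) | l′ ≡ᵇ (j ∸ l)
... | false | _     | _     | _     = refl
... | true  | false | false | _     = refl
... | true  | false | true  | _     = refl
... | true  | true  | true  | true  = refl
... | true  | true  | true  | false = sym (ℤP.*-zeroʳ a)
... | true  | true  | false | _     = sym (ℤP.*-zeroʳ a)

coeff-term*P : ∀ x p i j → ∑ℤ p (λ y → termCoeff (x ·ₜ y) i j) ≡ shiftCoeff x (coeff p) i j
coeff-term*P (a , k , l) p i j =
  trans (ℤ∑.∑-cong p (λ y → termCoeff-·ₜ (a , k , l) y i j)) (pull (k ≤ᵇ i) (l ≤ᵇ j))
  where
  pull : ∀ b b′ → ∑ℤ p (λ y → if b ∧ b′ then a *ℤ termCoeff y (i ∸ k) (j ∸ l) else 0ℤ)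
                ≡ (if b ∧ b′ then a *ℤ coeff p (i ∸ k) (j ∸ l) else 0ℤ)
  pull b b′ with b ∧ b′
  ... | false = ℤ∑.∑-0 p
  ... | true  = trans (sym (ℤ∑.*-distribˡ-∑ p a _)) (cong (a *ℤ_) (sym (coeff-∑ p _ _)))

·ₜ-comm : ∀ x y → x ·ₜ y ≡ y ·ₜ x
·ₜ-comm (a , k , l) (b , k′ , l′) = cong₂ _,_ (ℤP.*-comm a b) (cong₂ _,_ (ℕP.+-comm k k′) (ℕP.+-comm l l′))

·ₜ-assoc : ∀ x y z → (x ·ₜ y) ·ₜ z ≡ x ·ₜ (y ·ₜ z)
·ₜ-assoc (a , k , l) (b , k′ , l′) (c , k″ , l″) =
  cong₂ _,_ (ℤP.*-assoc a b c) (cong₂ _,_ (ℕP.+-assoc k k′ k″) (ℕP.+-assoc l l′ l″))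

infix 4 _≈_

-- A record wrapper around _≈P_, so that both sides can be inferred from an equation.
record _≈_ (p p′ : Poly) : Set where
  constructor fromCoeffs
  field toCoeffs : p ≈P p′
open _≈_ public

≈-refl : ∀ {p} → p ≈ p
≈-refl = fromCoeffs λ _ _ → refl

≈-sym : ∀ {p p′} → p ≈ p′ → p′ ≈ p
≈-sym (fromCoeffs e) = fromCoeffs λ i j → sym (e i j)

≈-trans : ∀ {p p′ p″} → p ≈ p′ → p′ ≈ p″ → p ≈ p″
≈-trans (fromCoeffs e) (fromCoeffs e′) = fromCoeffs λ i j → trans (e i j) (e′ i j)

≈-reflexive : ∀ {p p′} → p ≡ p′ → p ≈ p′
≈-reflexive refl = ≈-refl

+P-cong : ∀ {p p′ r r′} → p ≈ p′ → r ≈ r′ → (p +P r) ≈ (p′ +P r′)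
+P-cong {p} {p′} {r} {r′} (fromCoeffs p≈p′) (fromCoeffs r≈r′) = fromCoeffs λ i j →
  trans (coeff-+P p r i j) (trans (cong₂ _+ℤ_ (p≈p′ i j) (r≈r′ i j)) (sym (coeff-+P p′ r′ i j)))

+P-assoc : ∀ p r u → ((p +P r) +P u) ≈ (p +P (r +P u))
+P-assoc p r u = ≈-reflexive (ListP.++-assoc p r u)

+P-comm : ∀ p r → (p +P r) ≈ (r +P p)
+P-comm p r = fromCoeffs λ i j →
  trans (coeff-+P p r i j) (trans (ℤP.+-comm (coeff p i j) (coeff r i j)) (sym (coeff-+P r p i j)))

+P-identityˡ : ∀ p → ([] +P p) ≈ p
+P-identityˡ p = ≈-refl

+P-identityʳ : ∀ p → (p +P []) ≈ p
+P-identityʳ p = ≈-reflexive (ListP.++-identityʳ p)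

negP-inverseˡ : ∀ p → (negP p +P p) ≈ []
negP-inverseˡ p = fromCoeffs λ i j → trans (coeff-+P (negP p) p i j)
  (trans (cong (_+ℤ coeff p i j) (coeff-negP p i j)) (ℤP.+-inverseˡ (coeff p i j)))

negP-cong : ∀ {p p′} → p ≈ p′ → negP p ≈ negP p′
negP-cong {p} {p′} (fromCoeffs e) = fromCoeffs λ i j →
  trans (coeff-negP p i j) (trans (cong -_ (e i j)) (sym (coeff-negP p′ i j)))

*P-comm : ∀ p r → (p *P r) ≈ (r *P p)
*P-comm p r = fromCoeffs λ i j → begin
  coeff (p *P r) i j                                ≡⟨ coeff-*P p r i j ⟩
  ∑ℤ p (λ x → ∑ℤ r (λ y → termCoeff (x ·ₜ y) i j)) ≡⟨ ℤ∑.∑-cong p (λ x → ℤ∑.∑-cong r (λ y →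
                                                         cong (λ z → termCoeff z i j) (·ₜ-comm x y))) ⟩
  ∑ℤ p (λ x → ∑ℤ r (λ y → termCoeff (y ·ₜ x) i j)) ≡⟨ ℤ∑.∑-comm p r _ ⟩
  ∑ℤ r (λ y → ∑ℤ p (λ x → termCoeff (y ·ₜ x) i j)) ≡⟨ coeff-*P r p i j ⟨
  coeff (r *P p) i j                                ∎
  where open ≡-Reasoning

*P-congˡ : ∀ p {r r′} → r ≈ r′ → (p *P r) ≈ (p *P r′)
*P-congˡ p {r} {r′} (fromCoeffs r≈r′) = fromCoeffs λ i j → begin
  coeff (p *P r) i j                              ≡⟨ coeff-*P p r i j ⟩
  ∑ℤ p (λ x → ∑ℤ r (λ y → termCoeff (x ·ₜ y) i j)) ≡⟨ ℤ∑.∑-cong p (λ x → coeff-term*P x r i j) ⟩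
  ∑ℤ p (λ x → shiftCoeff x (coeff r) i j)         ≡⟨ ℤ∑.∑-cong p (λ x → shift-cong x i j) ⟩
  ∑ℤ p (λ x → shiftCoeff x (coeff r′) i j)        ≡⟨ ℤ∑.∑-cong p (λ x → coeff-term*P x r′ i j) ⟨
  ∑ℤ p (λ x → ∑ℤ r′ (λ y → termCoeff (x ·ₜ y) i j)) ≡⟨ coeff-*P p r′ i j ⟨
  coeff (p *P r′) i j                             ∎
  where
  open ≡-Reasoning
  shift-cong : ∀ x i j → shiftCoeff x (coeff r) i j ≡ shiftCoeff x (coeff r′) i j
  shift-cong (a , k , l) i j with (k ≤ᵇ i) ∧ (l ≤ᵇ j)
  ... | true  = cong (a *ℤ_) (r≈r′ _ _)
  ... | false = refl

*P-cong : ∀ {p p′ r r′} → p ≈ p′ → r ≈ r′ → (p *P r) ≈ (p′ *P r′)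
*P-cong {p} {p′} {r} {r′} p≈p′ r≈r′ =
  ≈-trans (*P-congˡ p r≈r′) (≈-trans (*P-comm p r′) (≈-trans (*P-congˡ r′ p≈p′) (*P-comm r′ p′)))

*P-assoc : ∀ p r u → ((p *P r) *P u) ≈ (p *P (r *P u))
*P-assoc p r u = fromCoeffs λ i j → begin
  coeff ((p *P r) *P u) i j
    ≡⟨ coeff-*P (p *P r) u i j ⟩
  ∑ℤ (p *P r) (λ xy → ∑ℤ u (λ z → termCoeff (xy ·ₜ z) i j))
    ≡⟨ ℤ∑.∑-concatMap _ p _ ⟩
  ∑ℤ p (λ x → ∑ℤ (List.map (x ·ₜ_) r) (λ xy → ∑ℤ u (λ z → termCoeff (xy ·ₜ z) i j)))
    ≡⟨ ℤ∑.∑-cong p (λ x → trans (ℤ∑.∑-map _ r _) (ℤ∑.∑-cong r (λ y → ℤ∑.∑-cong u (λ z →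
         cong (λ w → termCoeff w i j) (·ₜ-assoc x y z))))) ⟩
  ∑ℤ p (λ x → ∑ℤ r (λ y → ∑ℤ u (λ z → termCoeff (x ·ₜ (y ·ₜ z)) i j)))
    ≡⟨ ℤ∑.∑-cong p (λ x → trans (ℤ∑.∑-concatMap _ r _) (ℤ∑.∑-cong r (λ y → ℤ∑.∑-map _ u _))) ⟨
  ∑ℤ p (λ x → ∑ℤ (r *P u) (λ yz → termCoeff (x ·ₜ yz) i j))
    ≡⟨ coeff-*P p (r *P u) i j ⟨
  coeff (p *P (r *P u)) i j
    ∎
  where open ≡-Reasoning

*P-distribʳ : ∀ u p r → ((p +P r) *P u) ≈ ((p *P u) +P (r *P u))
*P-distribʳ u p r = fromCoeffs λ i j → begin
  coeff ((p +P r) *P u) i j                ≡⟨ coeff-*P (p +P r) u i j ⟩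
  ∑ℤ (p ++ r) _                             ≡⟨ ℤ∑.∑-++ p r _ ⟩
  ∑ℤ p _ +ℤ ∑ℤ r _                          ≡⟨ cong₂ _+ℤ_ (coeff-*P p u i j) (coeff-*P r u i j) ⟨
  coeff (p *P u) i j +ℤ coeff (r *P u) i j ≡⟨ coeff-+P (p *P u) (r *P u) i j ⟨
  coeff ((p *P u) +P (r *P u)) i j         ∎
  where open ≡-Reasoning

*P-identityˡ : ∀ p → (1P *P p) ≈ p
*P-identityˡ p = fromCoeffs λ i j → begin
  coeff (1P *P p) i j                                          ≡⟨ coeff-*P 1P p i j ⟩
  ∑ℤ p (λ y → termCoeff ((1ℤ , 0 , 0) ·ₜ y) i j) +ℤ 0ℤ        ≡⟨ ℤP.+-identityʳ _ ⟩
  ∑ℤ p (λ y → termCoeff ((1ℤ , 0 , 0) ·ₜ y) i j)               ≡⟨ ℤ∑.∑-cong p (unit i j) ⟩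
  ∑ℤ p (λ y → termCoeff y i j)                                 ≡⟨ coeff-∑ p i j ⟨
  coeff p i j                                                  ∎
  where
  open ≡-Reasoning
  unit : ∀ i j y → termCoeff ((1ℤ , 0 , 0) ·ₜ y) i j ≡ termCoeff y i j
  unit i j (b , k , l) = cong (λ b′ → termCoeff (b′ , k , l) i j) (ℤP.*-identityˡ b)

≈-setoid : Setoid 0ℓ 0ℓ
≈-setoid = record
  { Carrier       = Poly
  ; _≈_           = _≈_
  ; isEquivalence = record { refl = ≈-refl ; sym = ≈-sym ; trans = ≈-trans }
  }

polyRing : CommutativeRing 0ℓ 0ℓ
polyRing = record
  { Carrier = Poly ; _≈_ = _≈_ ; _+_ = _+P_ ; _*_ = _*P_ ; -_ = negP ; 0# = [] ; 1# = 1P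
  ; isCommutativeRing = record
    { isRing = record
      { +-isAbelianGroup = record
        { isGroup = record
          { isMonoid = record
            { isSemigroup = record
              { isMagma = record { isEquivalence = Setoid.isEquivalence ≈-setoid ; ∙-cong = +P-cong }
              ; assoc = +P-assoc }
            ; identity = comm∧idˡ⇒id +P-comm +P-identityˡ }
          ; inverse = comm∧invˡ⇒inv +P-comm negP-inverseˡ
          ; ⁻¹-cong = negP-cong }
        ; comm = +P-comm }
      ; *-cong = *P-cong
      ; *-assoc = *P-assoc
      ; *-identity = comm∧idˡ⇒id *P-comm *P-identityˡ
      ; distrib = comm∧distrʳ⇒distr +P-cong *P-comm *P-distribʳ }
    ; *-comm = *P-comm } }
  where
  open Consequences ≈-setoid using (comm∧idˡ⇒id; comm∧invˡ⇒inv; comm∧distrʳ⇒distr)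


open ListSum polyRing using (∑; ∑-cong; ∑-++; ∑-0; *-distribˡ-∑; *-distribʳ-∑; ∑-map; ∑-concatMap; ∑-comm)
module ≈-Reasoning = SetoidReasoning (CommutativeRing.setoid polyRing)
open MonoidSum (CommutativeRing.+-monoid polyRing) using (sum; sum-syntax) renaming (sum-cong-≋ to ∑ᶠ-cong)

polyACR : AlmostCommutativeRing _ _
polyACR = fromCommutativeRing polyRing (λ _ → nothing)

open CommSemigroupProperties (CommutativeRing.*-commutativeSemigroup polyRing) using (x∙yz≈y∙xz)

true≢false : true ≢ false
true≢false ()

bool-ext : ∀ {a b} → (a ≡ true → b ≡ true) → (b ≡ true → a ≡ true) → a ≡ b
bool-ext {true}  {b}     a⇒b b⇒a = sym (a⇒b refl)
bool-ext {false} {true}  a⇒b b⇒a = b⇒a refl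
bool-ext {false} {false} a⇒b b⇒a = refl

does⇒ : ∀ {P : Set} (P? : Dec P) → does P? ≡ true → P
does⇒ (yes p) _ = p

≢true⇒≡false : ∀ {b} → b ≢ true → b ≡ false
≢true⇒≡false {true}  b≢true = ⊥-elim (b≢true refl)
≢true⇒≡false {false} b≢true = refl

∨-true-elim : ∀ a {b} → a ∨ b ≡ true → a ≡ true ⊎ b ≡ true
∨-true-elim true  _  = inj₁ refl
∨-true-elim false eq = inj₂ eq

∨-true-introˡ : ∀ {a} b → a ≡ true → a ∨ b ≡ true
∨-true-introˡ b refl = refl

∨-true-introʳ : ∀ a {b} → b ≡ true → a ∨ b ≡ true
∨-true-introʳ a refl = BoolP.∨-zeroʳ a

∧-true-intro : ∀ {a b} → a ≡ true → b ≡ true → a ∧ b ≡ true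
∧-true-intro refl refl = refl

∧-true-elim : ∀ {a b} → a ∧ b ≡ true → a ≡ true × b ≡ true
∧-true-elim {a} {b} eq = BoolP.∧-conicalˡ a b eq , BoolP.∧-conicalʳ a b eq

==⇒≡ : ∀ {k} (u v : Fin k) → u == v ≡ true → u ≡ v
==⇒≡ u v eq with u Fin.≟ v
... | yes u≡v = u≡v

==-refl : ∀ {k} (u : Fin k) → u == u ≡ true
==-refl u = dec-true (u Fin.≟ u) refl

≢⇒==false : ∀ {k} (u v : Fin k) → u ≢ v → u == v ≡ false
≢⇒==false u v u≢v = dec-false (u Fin.≟ v) u≢v

<ᵇ⇒< : ∀ m n → (m <ᵇ n) ≡ true → m < n
<ᵇ⇒< m n eq = ℕP.<ᵇ⇒< m n (subst Bool.T (sym eq) _)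

<⇒<ᵇ : ∀ {m n} → m < n → (m <ᵇ n) ≡ true
<⇒<ᵇ m<n = Equivalence.to BoolP.T-≡ (ℕP.<⇒<ᵇ m<n)

≤⇒<ᵇfalse : ∀ {m n} → n ≤ m → (m <ᵇ n) ≡ false
≤⇒<ᵇfalse n≤m = ≢true⇒≡false λ eq → ℕP.<⇒≱ (<ᵇ⇒< _ _ eq) n≤m

BoolRel : ℕ → Set
BoolRel n = Fin n → Fin n → Bool

Holds : ∀ {n} → BoolRel n → Fin n → Fin n → Set
Holds R u v = R u v ≡ true

𝟙 : Bool → ℕ
𝟙 b = if b then 1 else 0

𝟙≤1 : ∀ b → 𝟙 b ≤ 1
𝟙≤1 true  = s≤s z≤n
𝟙≤1 false = z≤n

𝟙-mono : ∀ a b → (a ≡ true → b ≡ true) → 𝟙 a ≤ 𝟙 b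
𝟙-mono true  b a⇒b rewrite a⇒b refl = s≤s z≤n
𝟙-mono false b a⇒b = z≤n

anyFin : ∀ n → (Fin n → Bool) → Bool
anyFin zero    P = false
anyFin (suc n) P = P zero ∨ anyFin n (P ∘ suc)

countFin : ∀ n → (Fin n → Bool) → ℕ
countFin zero    P = 0
countFin (suc n) P = 𝟙 (P zero) + countFin n (P ∘ suc)

any-tabulate : ∀ {A : Set} n (P : A → Bool) (g : Fin n → A) →
               any P (List.tabulate g) ≡ anyFin n (P ∘ g)
any-tabulate zero    P g = refl
any-tabulate (suc n) P g = cong (P (g zero) ∨_) (any-tabulate n P (g ∘ suc))

countᵇ-tabulate : ∀ {A : Set} n (P : A → Bool) (g : Fin n → A) →
                  Vec.countᵇ P (Vec.tabulate g) ≡ countFin n (P ∘ g)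
countᵇ-tabulate zero    P g = refl
countᵇ-tabulate (suc n) P g with P (g zero)
... | true  = cong suc (countᵇ-tabulate n P (g ∘ suc))
... | false = countᵇ-tabulate n P (g ∘ suc)

anyFin-witness : ∀ n P → anyFin n P ≡ true → ∃ λ x → P x ≡ true
anyFin-witness (suc n) P eq with ∨-true-elim (P zero) eq
... | inj₁ P0  = zero , P0
... | inj₂ eq′ = Product.map suc id (anyFin-witness n (P ∘ suc) eq′)

anyFin-intro : ∀ n P (x : Fin n) → P x ≡ true → anyFin n P ≡ true
anyFin-intro (suc n) P zero    Px rewrite Px = refl
anyFin-intro (suc n) P (suc x) Px = trans (cong (P zero ∨_) (anyFin-intro n (P ∘ suc) x Px)) (BoolP.∨-zeroʳ _)

anyFin-false : ∀ n P → (∀ x → P x ≡ false) → anyFin n P ≡ false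
anyFin-false zero    P ¬P = refl
anyFin-false (suc n) P ¬P rewrite ¬P zero = anyFin-false n (P ∘ suc) (¬P ∘ suc)

anyFin-cong : ∀ n {P Q} → (∀ x → P x ≡ Q x) → anyFin n P ≡ anyFin n Q
anyFin-cong zero    P≗Q = refl
anyFin-cong (suc n) P≗Q = cong₂ _∨_ (P≗Q zero) (anyFin-cong n (P≗Q ∘ suc))

anyFin-mono : ∀ n P Q → (∀ x → P x ≡ true → Q x ≡ true) → anyFin n P ≡ true → anyFin n Q ≡ true
anyFin-mono n P Q P⇒Q eq with anyFin-witness n P eq
... | x , Px = anyFin-intro n Q x (P⇒Q x Px)

anyFin-+ : ∀ a b P → anyFin (a + b) P ≡ anyFin a (λ x → P (x ↑ˡ b)) ∨ anyFin b (λ y → P (a ↑ʳ y))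
anyFin-+ zero    b P = refl
anyFin-+ (suc a) b P =
  trans (cong (P zero ∨_) (anyFin-+ a b (P ∘ suc))) (sym (BoolP.∨-assoc (P zero) _ _))

anyFin-last : ∀ n P → anyFin (suc n) P ≡ anyFin n (P ∘ inject₁) ∨ P (fromℕ n)
anyFin-last zero    P = BoolP.∨-comm (P zero) false
anyFin-last (suc n) P =
  trans (cong (P zero ∨_) (anyFin-last n (P ∘ suc))) (sym (BoolP.∨-assoc (P zero) _ _))

countFin-cong : ∀ n {P Q} → (∀ x → P x ≡ Q x) → countFin n P ≡ countFin n Q
countFin-cong zero    P≗Q = refl
countFin-cong (suc n) P≗Q = cong₂ _+_ (cong 𝟙 (P≗Q zero)) (countFin-cong n (P≗Q ∘ suc))

countFin-≤ : ∀ n P → countFin n P ≤ n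
countFin-≤ zero    P = z≤n
countFin-≤ (suc n) P = ℕP.+-mono-≤ (𝟙≤1 (P zero)) (countFin-≤ n (P ∘ suc))

countFin-all : ∀ n P → (∀ x → P x ≡ true) → countFin n P ≡ n
countFin-all zero    P allP = refl
countFin-all (suc n) P allP rewrite allP zero = cong suc (countFin-all n (P ∘ suc) (allP ∘ suc))

countFin-none : ∀ n → countFin n (λ _ → false) ≡ 0
countFin-none zero    = refl
countFin-none (suc n) = countFin-none n

countFin-mono : ∀ n P Q → (∀ x → P x ≡ true → Q x ≡ true) → countFin n P ≤ countFin n Q
countFin-mono zero    P Q P⇒Q = z≤n
countFin-mono (suc n) P Q P⇒Q =
  ℕP.+-mono-≤ (𝟙-mono _ _ (P⇒Q zero)) (countFin-mono n (P ∘ suc) (Q ∘ suc) (P⇒Q ∘ suc))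

countFin-strict : ∀ n P Q → (∀ x → P x ≡ true → Q x ≡ true) →
                  ∀ x → P x ≡ false → Q x ≡ true → countFin n P < countFin n Q
countFin-strict (suc n) P Q P⇒Q zero    ¬Px Qx rewrite ¬Px | Qx =
  s≤s (countFin-mono n (P ∘ suc) (Q ∘ suc) (P⇒Q ∘ suc))
countFin-strict (suc n) P Q P⇒Q (suc x) ¬Px Qx =
  ℕP.+-mono-≤-< (𝟙-mono _ _ (P⇒Q zero)) (countFin-strict n (P ∘ suc) (Q ∘ suc) (P⇒Q ∘ suc) x ¬Px Qx)

countFin-except : ∀ n P Q (w : Fin n) → (∀ x → x ≢ w → P x ≡ Q x) → P w ≡ true → Q w ≡ false →
                  countFin n P ≡ suc (countFin n Q)
countFin-except (suc n) P Q zero    P≗Q Pw ¬Qw rewrite Pw | ¬Qw =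
  cong suc (countFin-cong n (λ x → P≗Q (suc x) λ ()))
countFin-except (suc n) P Q (suc w) P≗Q Pw ¬Qw rewrite P≗Q zero (λ ()) =
  trans (cong (𝟙 (Q zero) +_) (countFin-except n (P ∘ suc) (Q ∘ suc) w
          (λ x x≢w → P≗Q (suc x) (x≢w ∘ FinP.suc-injective)) Pw ¬Qw))
        (ℕP.+-suc (𝟙 (Q zero)) _)

countFin-+ : ∀ a b P → countFin (a + b) P ≡ countFin a (λ x → P (x ↑ˡ b)) + countFin b (λ y → P (a ↑ʳ y))
countFin-+ zero    b P = refl
countFin-+ (suc a) b P =
  trans (cong (𝟙 (P zero) +_) (countFin-+ a b (P ∘ suc))) (sym (ℕP.+-assoc (𝟙 (P zero)) _ _))

countFin-last : ∀ n P → countFin (suc n) P ≡ countFin n (P ∘ inject₁) + 𝟙 (P (fromℕ n))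
countFin-last zero    P = ℕP.+-comm (𝟙 (P zero)) 0
countFin-last (suc n) P =
  trans (cong (𝟙 (P zero) +_) (countFin-last n (P ∘ suc))) (sym (ℕP.+-assoc (𝟙 (P zero)) _ _))

-- Connectivity

graph : (nv ne : ℕ) → (Fin ne → Fin nv × Fin nv) → Graph
graph nv ne ends′ = record { n = nv ; m = ne ; ends = ends′ }

module _ (G : Graph) (S : Subset (m G)) where

  private
    src tgt : Fin (m G) → Fin (n G)
    src e = proj₁ (ends G e)
    tgt e = proj₂ (ends G e)

  Invariant : (Fin (n G) → Bool) → Set
  Invariant f = ∀ e → lookup S e ≡ true → f (src e) ≡ f (tgt e)

  private
    step : ℕ → Fin (n G) → Fin (n G) → Fin (m G) → Bool
    step k u v e = lookup S e ∧ ((reach G S k u (src e) ∧ (tgt e == v)) ∨ (reach G S k u (tgt e) ∧ (src e == v)))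

    reach-suc : ∀ k u v → reach G S (suc k) u v ≡ reach G S k u v ∨ anyFin (m G) (step k u v)
    reach-suc k u v = cong (reach G S k u v ∨_) (any-tabulate (m G) (step k u v) id)

  reach-invariant : ∀ f → Invariant f → ∀ k u v → reach G S k u v ≡ true → f u ≡ f v
  reach-invariant f inv zero    u v eq = cong f (==⇒≡ u v eq)
  reach-invariant f inv (suc k) u v eq with ∨-true-elim (reach G S k u v) (trans (sym (reach-suc k u v)) eq)
  ... | inj₁ r = reach-invariant f inv k u v r
  ... | inj₂ r with anyFin-witness (m G) (step k u v) r
  ...   | e , st with ∧-true-elim st
  ...     | Se , st′ with ∨-true-elim (reach G S k u (src e) ∧ (tgt e == v)) st′
  ...       | inj₁ fwd = trans (reach-invariant f inv k u (src e) (proj₁ (∧-true-elim fwd)))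
                          (trans (inv e Se) (cong f (==⇒≡ _ _ (proj₂ (∧-true-elim fwd)))))
  ...       | inj₂ bwd = trans (reach-invariant f inv k u (tgt e) (proj₁ (∧-true-elim bwd)))
                          (trans (sym (inv e Se)) (cong f (==⇒≡ _ _ (proj₂ (∧-true-elim bwd)))))

  private
    reach-suc-intro : ∀ k u v → reach G S k u v ≡ true → reach G S (suc k) u v ≡ true
    reach-suc-intro k u v = ∨-true-introˡ _

    reach-refl : ∀ k u → reach G S k u u ≡ true
    reach-refl zero    u = ==-refl u
    reach-refl (suc k) u = reach-suc-intro k u u (reach-refl k u)

    reach-forward : ∀ k u e → lookup S e ≡ true → reach G S k u (src e) ≡ true → reach G S (suc k) u (tgt e) ≡ true
    reach-forward k u e Se r = trans (reach-suc k u (tgt e)) (∨-true-introʳ (reach G S k u (tgt e))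
      (anyFin-intro (m G) (step k u (tgt e)) e (∧-true-intro Se (∨-true-introˡ _ (∧-true-intro r (==-refl (tgt e)))))))

    reach-backward : ∀ k u e → lookup S e ≡ true → reach G S k u (tgt e) ≡ true → reach G S (suc k) u (src e) ≡ true
    reach-backward k u e Se r = trans (reach-suc k u (src e)) (∨-true-introʳ (reach G S k u (src e))
      (anyFin-intro (m G) (step k u (src e)) e (∧-true-intro Se (∨-true-introʳ (reach G S k u (src e) ∧ (tgt e == src e))
        (∧-true-intro r (==-refl (src e)))))))

    Stable : ℕ → Fin (n G) → Set
    Stable k u = ∀ v → reach G S (suc k) u v ≡ reach G S k u v

    stable-suc : ∀ k u → Stable k u → Stable (suc k) u
    stable-suc k u st v = trans (reach-suc (suc k) u v) (trans (cong₂ _∨_ (st v)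
      (anyFin-cong (m G) λ e → cong (lookup S e ∧_) (cong₂ _∨_ (cong (_∧ (tgt e == v)) (st (src e)))
                                                           (cong (_∧ (src e == v)) (st (tgt e))))))
      (sym (reach-suc k u v)))

    -- Until it stabilises, each step reaches at least one new vertex.
    reach-grows : ∀ u k → k < countFin (n G) (reach G S k u) ⊎ Stable k u
    reach-grows u zero = inj₁ (subst (_< countFin (n G) (reach G S zero u)) (countFin-none (n G))
      (countFin-strict (n G) (λ _ → false) (reach G S zero u) (λ _ ()) u refl (reach-refl zero u)))
    reach-grows u (suc k) with reach-grows u k
    ... | inj₂ st = inj₂ (stable-suc k u st)
    ... | inj₁ k<count with FinP.all? (λ v → reach G S (suc k) u v Bool.≟ reach G S k u v)
    ...   | yes st = inj₂ (stable-suc k u st)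
    ...   | no ¬st with FinP.¬∀⟶∃¬ (n G) _ (λ v → reach G S (suc k) u v Bool.≟ reach G S k u v) ¬st
    ...     | v , new = inj₁ (ℕP.<-≤-trans (s≤s k<count)
                          (countFin-strict (n G) _ _ (reach-suc-intro k u) v old (BoolP.¬-not (new ∘ now-equal))))
      where
      old : reach G S k u v ≡ false
      old = ≢true⇒≡false λ r → new (trans (reach-suc-intro k u v r) (sym r))
      now-equal : reach G S (suc k) u v ≡ false → reach G S (suc k) u v ≡ reach G S k u v
      now-equal eq = trans eq (sym old)

    reach-stable : ∀ u v → reach G S (suc (n G)) u v ≡ true → connected G S u v ≡ true
    reach-stable u v r with reach-grows u (n G)
    ... | inj₁ n<count = ⊥-elim (ℕP.<-irrefl refl (ℕP.<-≤-trans n<count (countFin-≤ (n G) _)))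
    ... | inj₂ st      = trans (sym (st v)) r

  connected⇒invariant : ∀ {u v} → connected G S u v ≡ true → ∀ f → Invariant f → f u ≡ f v
  connected⇒invariant {u} {v} c f inv = reach-invariant f inv (n G) u v c

  invariant⇒connected : ∀ u v → (∀ f → Invariant f → f u ≡ f v) → connected G S u v ≡ true
  invariant⇒connected u v agree = trans (sym (agree (connected G S u) component-invariant)) (reach-refl (n G) u)
    where
    component-invariant : Invariant (connected G S u)
    component-invariant e Se = bool-ext (reach-stable u (tgt e) ∘ reach-forward (n G) u e Se)
                                        (reach-stable u (src e) ∘ reach-backward (n G) u e Se)

  connected-sym : Symmetric (Holds (connected G S))
  connected-sym {u} {v} c = invariant⇒connected v u λ f inv → sym (connected⇒invariant c f inv)

  connected-trans : Transitive (Holds (connected G S))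
  connected-trans {u} {v} {w} c c′ = invariant⇒connected u w λ f inv →
    trans (connected⇒invariant c f inv) (connected⇒invariant c′ f inv)

  connected-edge : ∀ e → lookup S e ≡ true → connected G S (src e) (tgt e) ≡ true
  connected-edge e Se = invariant⇒connected (src e) (tgt e) λ f inv → inv e Se

isLeader : ∀ k → BoolRel k → Fin k → Bool
isLeader k R v = not (anyFin k (λ u → (toℕ u <ᵇ toℕ v) ∧ R u v))

countLeaders : ∀ k → BoolRel k → ℕ
countLeaders k R = countFin k (isLeader k R)

countLeaders-cong : ∀ k {R R′} → (∀ u v → R u v ≡ R′ u v) → countLeaders k R ≡ countLeaders k R′
countLeaders-cong k R≗R′ = countFin-cong k λ v → cong not (anyFin-cong k λ u → cong ((toℕ u <ᵇ toℕ v) ∧_) (R≗R′ u v))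

compS≡countLeaders : ∀ G S → compS G S ≡ countLeaders (n G) (connected G S)
compS≡countLeaders G S = trans (countᵇ-tabulate (n G) _ id) (countFin-cong (n G) λ v →
  cong not (any-tabulate (n G) (λ u → (toℕ u <ᵇ toℕ v) ∧ connected G S u v) id))

compS≤n : ∀ G S → compS G S ≤ n G
compS≤n G S = subst (_≤ n G) (sym (compS≡countLeaders G S)) (countFin-≤ (n G) _)

compS-cong : ∀ G {k} {ends′ : Fin k → Fin (n G) × Fin (n G)} S S′ →
             (∀ u v → connected G S u v ≡ connected (graph (n G) k ends′) S′ u v) →
             compS G S ≡ compS (graph (n G) k ends′) S′
compS-cong G {k} {ends′} S S′ same = trans (compS≡countLeaders G S)
  (trans (countLeaders-cong (n G) same) (sym (compS≡countLeaders (graph (n G) k ends′) S′)))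

-- Deletion, contraction, relabelling and disjoint union of graphs

sortPair : ∀ {n} → Fin n → Fin n → Fin n × Fin n
sortPair x y with toℕ x ℕ.≤? toℕ y
... | yes _ = x , y
... | no  _ = y , x

sortPair-cases : ∀ {n} (x y : Fin n) → sortPair x y ≡ (x , y) ⊎ sortPair x y ≡ (y , x)
sortPair-cases x y with toℕ x ℕ.≤? toℕ y
... | yes _ = inj₁ refl
... | no  _ = inj₂ refl

sortPair-sorted : ∀ {n} (x y : Fin n) → toℕ (proj₁ (sortPair x y)) ≤ toℕ (proj₂ (sortPair x y))
sortPair-sorted x y with toℕ x ℕ.≤? toℕ y
... | yes x≤y = x≤y
... | no  x≰y = ℕP.<⇒≤ (ℕP.≰⇒> x≰y)

punchIn-view : ∀ {k} (e x : Fin (suc k)) → x ≡ e ⊎ ∃ λ j → punchIn e j ≡ x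
punchIn-view e x with e Fin.≟ x
... | yes e≡x = inj₁ (sym e≡x)
... | no e≢x  = inj₂ (punchOut e≢x , FinP.punchIn-punchOut e≢x)

module _ {nv k : ℕ} (ends′ : Fin (suc k) → Fin nv × Fin nv) (e : Fin (suc k)) where

  private
    G : Graph
    G = graph nv (suc k) ends′

  deleteEdge : Graph
  deleteEdge = graph nv k (ends′ ∘ punchIn e)

  compS-deleteEdge : ∀ S → compS G (insertAt S e false) ≡ compS deleteEdge S
  compS-deleteEdge S = compS-cong G (insertAt S e false) S λ u v → bool-ext
    (λ c → invariant⇒connected deleteEdge S u v λ f inv → connected⇒invariant G _ c f (invariant-G f inv))
    (λ c → invariant⇒connected G _ u v λ f inv → connected⇒invariant deleteEdge S c f λ j Sj →
       inv (punchIn e j) (trans (VecP.insertAt-punchIn S e false j) Sj))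
    where
    invariant-G : ∀ f → Invariant deleteEdge S f → Invariant G (insertAt S e false) f
    invariant-G f inv x Sx with punchIn-view e x
    ... | inj₁ refl       = ⊥-elim (true≢false (trans (sym Sx) (VecP.insertAt-lookup S e false)))
    ... | inj₂ (j , refl) = inv j (trans (sym (VecP.insertAt-punchIn S e false j)) Sx)

  private
    lo hi : Fin nv
    lo = proj₁ (sortPair (proj₁ (ends′ e)) (proj₂ (ends′ e)))
    hi = proj₂ (sortPair (proj₁ (ends′ e)) (proj₂ (ends′ e)))

    merge : Fin nv → Fin nv
    merge z = if z == hi then lo else z

  -- The larger end hi is merged into lo and left behind as an isolated vertex: the vertex set stays
  -- Fin nv and every other component keeps its least vertex.
  contractEdge : Graph
  contractEdge = graph nv k (λ j → merge (proj₁ (ends′ (punchIn e j))) , merge (proj₂ (ends′ (punchIn e j))))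

  nonLoop : Bool
  nonLoop = not (lo == hi)

  private
    ends-sorted : ∀ {A : Set} (g : Fin nv → A) → g (proj₁ (ends′ e)) ≡ g (proj₂ (ends′ e)) → g lo ≡ g hi
    ends-sorted g g-ends with sortPair-cases (proj₁ (ends′ e)) (proj₂ (ends′ e))
    ... | inj₁ eq = trans (cong (g ∘ proj₁) eq) (trans g-ends (sym (cong (g ∘ proj₂) eq)))
    ... | inj₂ eq = trans (cong (g ∘ proj₁) eq) (trans (sym g-ends) (sym (cong (g ∘ proj₂) eq)))

    ends-unsorted : ∀ {A : Set} (g : Fin nv → A) → g lo ≡ g hi → g (proj₁ (ends′ e)) ≡ g (proj₂ (ends′ e))
    ends-unsorted g g-lohi with sortPair-cases (proj₁ (ends′ e)) (proj₂ (ends′ e))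
    ... | inj₁ eq = trans (sym (cong (g ∘ proj₁) eq)) (trans g-lohi (cong (g ∘ proj₂) eq))
    ... | inj₂ eq = trans (sym (cong (g ∘ proj₂) eq)) (trans (sym g-lohi) (cong (g ∘ proj₁) eq))

    lo<hi : lo ≢ hi → toℕ lo < toℕ hi
    lo<hi lo≢hi = ℕP.≤∧≢⇒< (sortPair-sorted (proj₁ (ends′ e)) (proj₂ (ends′ e))) (lo≢hi ∘ FinP.toℕ-injective)

    merge-id : ∀ {z} → z ≢ hi → merge z ≡ z
    merge-id {z} z≢hi rewrite ≢⇒==false z hi z≢hi = refl

    merge-lo : merge lo ≡ lo
    merge-lo with lo Fin.≟ hi
    ... | yes _ = refl
    ... | no  _ = refl

    merge-hi : merge hi ≡ lo
    merge-hi rewrite ==-refl hi = refl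

    merge-≢hi : lo ≢ hi → ∀ z → merge z ≢ hi
    merge-≢hi lo≢hi z with z Fin.≟ hi
    ... | yes _   = lo≢hi
    ... | no z≢hi = z≢hi

    merge-loop : lo ≡ hi → ∀ z → merge z ≡ z
    merge-loop lo≡hi z with z Fin.≟ hi
    ... | yes refl = lo≡hi
    ... | no z≢hi  = refl

    merge-invariant : ∀ (g : Fin nv → Bool) → g lo ≡ g hi → ∀ z → g (merge z) ≡ g z
    merge-invariant g g-lohi z with z Fin.≟ hi
    ... | yes refl = g-lohi
    ... | no _     = refl

  module _ (S : Subset k) where

    private
      R R′ : Fin nv → Fin nv → Bool
      R  = connected G (insertAt S e true)
      R′ = connected contractEdge S

      e∈T : lookup (insertAt S e true) e ≡ true
      e∈T = VecP.insertAt-lookup S e true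

      R′⇒R : ∀ x y → R′ x y ≡ true → R x y ≡ true
      R′⇒R x y c = invariant⇒connected G _ x y λ g inv →
        let g-merge = merge-invariant g (ends-sorted g (inv e e∈T)) in
        connected⇒invariant contractEdge S c g λ j Sj →
          trans (g-merge _) (trans (inv (punchIn e j) (trans (VecP.insertAt-punchIn S e true j) Sj)) (sym (g-merge _)))

      R⇒R′ : ∀ {x y} → merge x ≡ x → merge y ≡ y → R x y ≡ true → R′ x y ≡ true
      R⇒R′ {x} {y} fix-x fix-y c = invariant⇒connected contractEdge S x y λ f inv →
        trans (cong f (sym fix-x)) (trans (connected⇒invariant G _ c (f ∘ merge) (merged-invariant f inv)) (cong f fix-y))
        where
        merged-invariant : ∀ f → Invariant contractEdge S f → Invariant G (insertAt S e true) (f ∘ merge)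
        merged-invariant f inv x Sx with punchIn-view e x
        ... | inj₁ refl       = ends-unsorted (f ∘ merge) (cong f (trans merge-lo (sym merge-hi)))
        ... | inj₂ (j , refl) = inv j (trans (sym (VecP.insertAt-punchIn S e true j)) Sx)

      R-lo-hi : R lo hi ≡ true
      R-lo-hi with sortPair-cases (proj₁ (ends′ e)) (proj₂ (ends′ e))
      ... | inj₁ eq = subst₂ (λ x y → R x y ≡ true) (sym (cong proj₁ eq)) (sym (cong proj₂ eq))
                        (connected-edge G _ e e∈T)
      ... | inj₂ eq = subst₂ (λ x y → R x y ≡ true) (sym (cong proj₁ eq)) (sym (cong proj₂ eq))
                        (connected-sym G _ (connected-edge G _ e e∈T))

      hi-isolated : lo ≢ hi → ∀ y → R′ hi y ≡ true → y ≡ hi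
      hi-isolated lo≢hi y c = ==⇒≡ y hi (trans (sym (connected⇒invariant contractEdge S c (_== hi) λ j _ →
        trans (merge≠hi (proj₁ (ends′ (punchIn e j)))) (sym (merge≠hi (proj₂ (ends′ (punchIn e j))))))) (==-refl hi))
        where
        merge≠hi : ∀ z → (merge z == hi) ≡ false
        merge≠hi z = ≢⇒==false (merge z) hi (merge-≢hi lo≢hi z)

      leaders-away-from-hi : lo ≢ hi → ∀ v → v ≢ hi → isLeader nv R′ v ≡ isLeader nv R v
      leaders-away-from-hi lo≢hi v v≢hi = cong not (bool-ext
        (anyFin-mono nv _ _ λ u u<v∧R′ → let (u<v , c) = ∧-true-elim u<v∧R′ in ∧-true-intro u<v (R′⇒R u v c))
        (λ below → let (u , u<v∧R) = anyFin-witness nv _ below ; (u<v , c) = ∧-true-elim u<v∧R in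
          smaller-R′ u u<v c))
        where
        smaller-R′ : ∀ u → (toℕ u <ᵇ toℕ v) ≡ true → R u v ≡ true →
                     anyFin nv (λ u → (toℕ u <ᵇ toℕ v) ∧ R′ u v) ≡ true
        smaller-R′ u u<v c with u Fin.≟ hi
        ... | no u≢hi = anyFin-intro nv _ u (∧-true-intro u<v (R⇒R′ (merge-id u≢hi) (merge-id v≢hi) c))
        ... | yes u≡hi = anyFin-intro nv _ lo (∧-true-intro
                (<⇒<ᵇ (ℕP.<-trans (lo<hi lo≢hi) (subst (λ w → toℕ w < toℕ v) u≡hi (<ᵇ⇒< _ _ u<v))))
                (R⇒R′ (merge-id lo≢hi) (merge-id v≢hi) (connected-trans G _ R-lo-hi (subst (λ w → R w v ≡ true) u≡hi c))))

      hi-leader-after : lo ≢ hi → isLeader nv R′ hi ≡ true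
      hi-leader-after lo≢hi = cong not (anyFin-false nv _ λ u → ≢true⇒≡false λ u<hi∧R′ →
        let (u<hi , c) = ∧-true-elim u<hi∧R′ in
        ℕP.<-irrefl (cong toℕ (hi-isolated lo≢hi u (connected-sym contractEdge S c))) (<ᵇ⇒< _ _ u<hi))

      hi-not-leader-before : lo ≢ hi → isLeader nv R hi ≡ false
      hi-not-leader-before lo≢hi = cong not (anyFin-intro nv _ lo (∧-true-intro
        (<⇒<ᵇ (lo<hi lo≢hi)) R-lo-hi))

    compS-contractEdge : compS contractEdge S ≡ compS G (insertAt S e true) + 𝟙 nonLoop
    compS-contractEdge with lo Fin.≟ hi
    ... | yes lo≡hi = trans (compS-cong contractEdge S (insertAt S e true) λ u v →
                              bool-ext (R′⇒R u v) (R⇒R′ (merge-loop lo≡hi u) (merge-loop lo≡hi v)))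
                            (sym (ℕP.+-identityʳ _))
    ... | no lo≢hi = begin
      compS contractEdge S              ≡⟨ compS≡countLeaders contractEdge S ⟩
      countLeaders nv R′                ≡⟨ countFin-except nv _ _ hi (leaders-away-from-hi lo≢hi)
                                              (hi-leader-after lo≢hi) (hi-not-leader-before lo≢hi) ⟩
      suc (countLeaders nv R)           ≡⟨ cong suc (compS≡countLeaders G _) ⟨
      suc (compS G (insertAt S e true)) ≡⟨ ℕP.+-comm 1 _ ⟩
      compS G (insertAt S e true) + 1   ∎
      where open ≡-Reasoning

module _ {a b : ℕ} (f : Fin a ↔ Fin b) where

  open Inverse f

  preimage : Subset b → Subset a
  preimage S = Vec.tabulate (lookup S ∘ to)

  image-preimage : ∀ S → image f (preimage S) ≡ S
  image-preimage S = trans (VecP.tabulate-cong λ j →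
    trans (VecP.lookup∘tabulate (lookup S ∘ to) (from j)) (cong (lookup S) (strictlyInverseˡ j))) (VecP.tabulate∘lookup S)

  preimage-image : ∀ A → preimage (image f A) ≡ A
  preimage-image A = trans (VecP.tabulate-cong λ i →
    trans (VecP.lookup∘tabulate (lookup A ∘ from) (to i)) (cong (lookup A) (strictlyInverseʳ i))) (VecP.tabulate∘lookup A)

module _ (G : Graph) {k : ℕ} (f : Fin (m G) ↔ Fin k) where

  open Inverse f

  relabelEdges : Graph
  relabelEdges = graph (n G) k (ends G ∘ from)

  compS-relabelEdges : ∀ S → compS G (preimage f S) ≡ compS relabelEdges S
  compS-relabelEdges S = compS-cong G (preimage f S) S λ u v → bool-ext
    (λ c → invariant⇒connected relabelEdges S u v λ g inv → connected⇒invariant G _ c g λ i Si →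
      subst (λ z → g (proj₁ (ends G z)) ≡ g (proj₂ (ends G z))) (strictlyInverseʳ i)
            (inv (to i) (trans (sym (VecP.lookup∘tabulate (lookup S ∘ to) i)) Si)))
    (λ c → invariant⇒connected G _ u v λ g inv → connected⇒invariant relabelEdges S c g λ j Sj →
      inv (from j) (trans (VecP.lookup∘tabulate (lookup S ∘ to) (from j)) (trans (cong (lookup S) (strictlyInverseˡ j)) Sj)))

take-++ : ∀ {A : Set} a {b} (xs : Vec A a) (ys : Vec A b) → Vec.take a (xs Vec.++ ys) ≡ xs
take-++ zero    []       ys = refl
take-++ (suc a) (x ∷ xs) ys = cong (x ∷_) (take-++ a xs ys)

drop-++ : ∀ {A : Set} a {b} (xs : Vec A a) (ys : Vec A b) → Vec.drop a (xs Vec.++ ys) ≡ ys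
drop-++ zero    []       ys = refl
drop-++ (suc a) (x ∷ xs) ys = drop-++ a xs ys

lookup-↑ˡ : ∀ {A : Set} a {b} (xs : Vec A (a + b)) j → lookup xs (j ↑ˡ b) ≡ lookup (Vec.take a xs) j
lookup-↑ˡ a xs j = trans (cong (λ ys → lookup ys (j ↑ˡ _)) (sym (VecP.take++drop≡id a xs)))
                         (VecP.lookup-++ˡ (Vec.take a xs) _ j)

lookup-↑ʳ : ∀ {A : Set} a {b} (xs : Vec A (a + b)) j → lookup xs (a ↑ʳ j) ≡ lookup (Vec.drop a xs) j
lookup-↑ʳ a xs j = trans (cong (λ ys → lookup ys (a ↑ʳ j)) (sym (VecP.take++drop≡id a xs)))
                         (VecP.lookup-++ʳ (Vec.take a xs) _ j)

+-<ᵇ : ∀ k p q → ((k + p) <ᵇ (k + q)) ≡ (p <ᵇ q)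
+-<ᵇ zero    p q = refl
+-<ᵇ (suc k) p q = +-<ᵇ k p q

module _ (G₁ G₂ : Graph) where

  private
    n₁ = n G₁
    n₂ = n G₂
    m₁ = m G₁
    m₂ = m G₂

    unionEnds : Fin m₁ ⊎ Fin m₂ → Fin (n₁ + n₂) × Fin (n₁ + n₂)
    unionEnds (inj₁ j) = Product.map (_↑ˡ n₂) (_↑ˡ n₂) (ends G₁ j)
    unionEnds (inj₂ j) = Product.map (n₁ ↑ʳ_) (n₁ ↑ʳ_) (ends G₂ j)

  disjointUnion : Graph
  disjointUnion = graph (n₁ + n₂) (m₁ + m₂) (unionEnds ∘ Fin.splitAt m₁)

  private
    U = disjointUnion

    join : (Fin n₁ → Bool) → (Fin n₂ → Bool) → Fin (n₁ + n₂) → Bool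
    join g h = [ g , h ] ∘ Fin.splitAt n₁

    join-↑ˡ : ∀ g h x → join g h (x ↑ˡ n₂) ≡ g x
    join-↑ˡ g h x = cong [ g , h ] (FinP.splitAt-↑ˡ n₁ x n₂)

    join-↑ʳ : ∀ g h y → join g h (n₁ ↑ʳ y) ≡ h y
    join-↑ʳ g h y = cong [ g , h ] (FinP.splitAt-↑ʳ n₁ n₂ y)

  module _ (S : Subset (m₁ + m₂)) where

    private
      S₁ = Vec.take m₁ S
      S₂ = Vec.drop m₁ S
      R  = connected U S

      restrictˡ : ∀ f → Invariant U S f → Invariant G₁ S₁ (f ∘ (_↑ˡ n₂))
      restrictˡ f inv j S₁j = subst (λ p → f (proj₁ p) ≡ f (proj₂ p)) (cong unionEnds (FinP.splitAt-↑ˡ m₁ j m₂))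
                                (inv (j ↑ˡ m₂) (trans (lookup-↑ˡ m₁ S j) S₁j))

      restrictʳ : ∀ f → Invariant U S f → Invariant G₂ S₂ (f ∘ (n₁ ↑ʳ_))
      restrictʳ f inv j S₂j = subst (λ p → f (proj₁ p) ≡ f (proj₂ p)) (cong unionEnds (FinP.splitAt-↑ʳ m₁ m₂ j))
                                (inv (m₁ ↑ʳ j) (trans (lookup-↑ʳ m₁ S j) S₂j))

      join-invariant : ∀ g h → Invariant G₁ S₁ g → Invariant G₂ S₂ h → Invariant U S (join g h)
      join-invariant g h inv₁ inv₂ x Sx with Fin.splitAt m₁ x in eq
      ... | inj₁ j = trans (join-↑ˡ g h _) (trans (inv₁ j (trans (sym (lookup-↑ˡ m₁ S j))
                       (subst (λ z → lookup S z ≡ true) (sym (FinP.splitAt⁻¹-↑ˡ eq)) Sx))) (sym (join-↑ˡ g h _)))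
      ... | inj₂ j = trans (join-↑ʳ g h _) (trans (inv₂ j (trans (sym (lookup-↑ʳ m₁ S j))
                       (subst (λ z → lookup S z ≡ true) (sym (FinP.splitAt⁻¹-↑ʳ eq)) Sx))) (sym (join-↑ʳ g h _)))

      connected-↑ˡ : ∀ x y → R (x ↑ˡ n₂) (y ↑ˡ n₂) ≡ connected G₁ S₁ x y
      connected-↑ˡ x y = bool-ext
        (λ c → invariant⇒connected G₁ S₁ x y λ g inv → trans (sym (join-↑ˡ g _ x))
          (trans (connected⇒invariant U S c (join g _) (join-invariant g _ inv λ _ _ → refl)) (join-↑ˡ g (λ _ → false) y)))
        (λ c → invariant⇒connected U S _ _ λ f inv → connected⇒invariant G₁ S₁ c _ (restrictˡ f inv))

      connected-↑ʳ : ∀ x y → R (n₁ ↑ʳ x) (n₁ ↑ʳ y) ≡ connected G₂ S₂ x y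
      connected-↑ʳ x y = bool-ext
        (λ c → invariant⇒connected G₂ S₂ x y λ h inv → trans (sym (join-↑ʳ _ h x))
          (trans (connected⇒invariant U S c (join _ h) (join-invariant _ h (λ _ _ → refl) inv)) (join-↑ʳ (λ _ → false) h y)))
        (λ c → invariant⇒connected U S _ _ λ f inv → connected⇒invariant G₂ S₂ c _ (restrictʳ f inv))

      side : Fin (n₁ + n₂) → Bool
      side = join (λ _ → true) (λ _ → false)

      side-invariant : Invariant U S side
      side-invariant = join-invariant _ _ (λ _ _ → refl) (λ _ _ → refl)

      disconnected : ∀ {u v} → side u ≢ side v → R u v ≡ false
      disconnected side≢ = ≢true⇒≡false λ c → side≢ (connected⇒invariant U S c side side-invariant)

      isLeader-↑ˡ : ∀ x → isLeader (n₁ + n₂) R (x ↑ˡ n₂) ≡ isLeader n₁ (connected G₁ S₁) x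
      isLeader-↑ˡ x = cong not (trans (anyFin-+ n₁ n₂ _) (trans (cong₂ _∨_
        (anyFin-cong n₁ λ z → cong₂ _∧_ (cong₂ _<ᵇ_ (FinP.toℕ-↑ˡ z n₂) (FinP.toℕ-↑ˡ x n₂)) (connected-↑ˡ z x))
        (anyFin-false n₂ _ λ z → trans (cong (_ ∧_) (disconnected
          (λ eq → true≢false (trans (sym (join-↑ˡ _ _ x)) (trans (sym eq) (join-↑ʳ _ _ z)))))) (BoolP.∧-zeroʳ _)))
        (BoolP.∨-identityʳ _)))

      isLeader-↑ʳ : ∀ y → isLeader (n₁ + n₂) R (n₁ ↑ʳ y) ≡ isLeader n₂ (connected G₂ S₂) y
      isLeader-↑ʳ y = cong not (trans (anyFin-+ n₁ n₂ _) (cong₂ _∨_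
        (anyFin-false n₁ _ λ z → trans (cong (_ ∧_) (disconnected
          (λ eq → true≢false (trans (sym (join-↑ˡ _ _ z)) (trans eq (join-↑ʳ _ _ y)))))) (BoolP.∧-zeroʳ _))
        (anyFin-cong n₂ λ z → cong₂ _∧_
          (trans (cong₂ _<ᵇ_ (FinP.toℕ-↑ʳ n₁ z) (FinP.toℕ-↑ʳ n₁ y)) (+-<ᵇ n₁ (toℕ z) (toℕ y))) (connected-↑ʳ z y))))

    compS-disjointUnion : compS U S ≡ compS G₁ S₁ + compS G₂ S₂
    compS-disjointUnion = begin
      compS U S                                                   ≡⟨ compS≡countLeaders U S ⟩
      countLeaders (n₁ + n₂) R                                    ≡⟨ countFin-+ n₁ n₂ _ ⟩
      countFin n₁ (isLeader (n₁ + n₂) R ∘ (_↑ˡ n₂)) + countFin n₂ (isLeader (n₁ + n₂) R ∘ (n₁ ↑ʳ_))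
        ≡⟨ cong₂ _+_ (countFin-cong n₁ isLeader-↑ˡ) (countFin-cong n₂ isLeader-↑ʳ) ⟩
      countLeaders n₁ (connected G₁ S₁) + countLeaders n₂ (connected G₂ S₂)
        ≡⟨ cong₂ _+_ (compS≡countLeaders G₁ S₁) (compS≡countLeaders G₂ S₂) ⟨
      compS G₁ S₁ + compS G₂ S₂                                   ∎
      where open ≡-Reasoning

compS-antitone : ∀ G S T → (∀ e → lookup S e ≡ true → lookup T e ≡ true) → compS G T ≤ compS G S
compS-antitone G S T S⊆T = subst₂ _≤_ (sym (compS≡countLeaders G T)) (sym (compS≡countLeaders G S))
  (countFin-mono (n G) _ _ λ v → not-antitone (anyFin-mono (n G) _ _ λ u u<v∧c →
    let (u<v , c) = ∧-true-elim u<v∧c in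
    ∧-true-intro u<v (invariant⇒connected G T u v λ f inv → connected⇒invariant G S c f λ e Se → inv e (S⊆T e Se))))
  where
  not-antitone : ∀ {a b} → (a ≡ true → b ≡ true) → not b ≡ true → not a ≡ true
  not-antitone {false} a⇒b _ = refl
  not-antitone {true}  a⇒b ¬b = trans (cong not (sym (a⇒b refl))) ¬b

compS-edgeless : ∀ {nv} (ends′ : Fin 0 → Fin nv × Fin nv) → compS (graph nv 0 ends′) [] ≡ nv
compS-edgeless {nv} ends′ = trans (compS≡countLeaders G []) (countFin-all nv _ λ v →
  cong not (anyFin-false nv _ λ u → ≢true⇒≡false λ u<v∧c → let (u<v , c) = ∧-true-elim u<v∧c in
    ℕP.<-irrefl (cong toℕ (only-self c)) (<ᵇ⇒< _ _ u<v)))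
  where
  G = graph nv 0 ends′
  only-self : ∀ {u v} → connected G [] u v ≡ true → u ≡ v
  only-self {u} {v} c = ==⇒≡ u v (trans (sym (connected⇒invariant G [] c (u ==_) λ ())) (==-refl u))

-- Every edge of S lowers the number of components by at most one.
rank-bound : ∀ {nv k} (ends′ : Fin k → Fin nv × Fin nv) S → nv ≤ ∣ S ∣ + compS (graph nv k ends′) S
rank-bound {k = zero}  ends′ []          = ℕP.≤-reflexive (sym (compS-edgeless ends′))
rank-bound {k = suc k} ends′ (false ∷ S) =
  subst (λ c → _ ≤ ∣ S ∣ + c) (sym (compS-deleteEdge ends′ zero S)) (rank-bound (ends′ ∘ suc) S)
rank-bound {k = suc k} ends′ (true ∷ S)  = begin
  _                                                           ≤⟨ rank-bound _ S ⟩
  ∣ S ∣ + compS (contractEdge ends′ zero) S                    ≡⟨ cong (∣ S ∣ +_) (compS-contractEdge ends′ zero S) ⟩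
  ∣ S ∣ + (compS G (true ∷ S) + 𝟙 (nonLoop ends′ zero))        ≤⟨ ℕP.+-monoʳ-≤ ∣ S ∣ (ℕP.+-monoʳ-≤ _ (𝟙≤1 _)) ⟩
  ∣ S ∣ + (compS G (true ∷ S) + 1)                             ≡⟨ cong (∣ S ∣ +_) (ℕP.+-comm (compS G (true ∷ S)) 1) ⟩
  ∣ S ∣ + suc (compS G (true ∷ S))                             ≡⟨ ℕP.+-suc ∣ S ∣ (compS G (true ∷ S)) ⟩
  suc ∣ S ∣ + compS G (true ∷ S)                               ∎
  where
  open ℕP.≤-Reasoning
  G = graph _ (suc k) ends′

-- Sums over all subsets

subsets : ∀ k → List (Subset k)
subsets zero    = [] ∷ []
subsets (suc k) = List.map (false ∷_) (subsets k) ++ List.map (true ∷_) (subsets k)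

∑ˢ : ∀ k → (Subset k → Poly) → Poly
∑ˢ k F = ∑ (subsets k) F

∑ˢ-cong : ∀ k {F F′ : Subset k → Poly} → (∀ A → F A ≈ F′ A) → ∑ˢ k F ≈ ∑ˢ k F′
∑ˢ-cong k = ∑-cong (subsets k)

∑ˢ-suc : ∀ k F → ∑ˢ (suc k) F ≈ ∑ˢ k (F ∘ (false ∷_)) +P ∑ˢ k (F ∘ (true ∷_))
∑ˢ-suc k F = ≈-trans (∑-++ (List.map (false ∷_) (subsets k)) _ F)
  (+P-cong (≈-reflexive (∑-map _ (subsets k) F)) (≈-reflexive (∑-map _ (subsets k) F)))

∑ˢ-insertAt : ∀ k (e : Fin (suc k)) F →
              ∑ˢ (suc k) F ≈ ∑ˢ k (λ A → F (insertAt A e false)) +P ∑ˢ k (λ A → F (insertAt A e true))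
∑ˢ-insertAt k       zero    F = ∑ˢ-suc k F
∑ˢ-insertAt (suc k) (suc e) F = begin
  ∑ˢ (suc (suc k)) F                                  ≈⟨ ∑ˢ-suc (suc k) F ⟩
  ∑ˢ (suc k) (F ∘ (false ∷_)) +P ∑ˢ (suc k) (F ∘ (true ∷_))
    ≈⟨ +P-cong (∑ˢ-insertAt k e (F ∘ (false ∷_))) (∑ˢ-insertAt k e (F ∘ (true ∷_))) ⟩
  (F₀₀ +P F₀₁) +P (F₁₀ +P F₁₁)                        ≈⟨ interchange F₀₀ F₀₁ F₁₀ F₁₁ ⟩
  (F₀₀ +P F₁₀) +P (F₀₁ +P F₁₁)                        ≈⟨ +P-cong (∑ˢ-suc k _) (∑ˢ-suc k _) ⟨
  ∑ˢ (suc k) (λ A → F (insertAt A (suc e) false)) +P ∑ˢ (suc k) (λ A → F (insertAt A (suc e) true))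
    ∎
  where
  open ≈-Reasoning
  open CommSemigroupProperties (CommutativeRing.+-commutativeSemigroup polyRing) using (interchange)
  F₀₀ F₀₁ F₁₀ F₁₁ : Poly
  F₀₀ = ∑ˢ k (λ A → F (false ∷ insertAt A e false))
  F₀₁ = ∑ˢ k (λ A → F (false ∷ insertAt A e true))
  F₁₀ = ∑ˢ k (λ A → F (true ∷ insertAt A e false))
  F₁₁ = ∑ˢ k (λ A → F (true ∷ insertAt A e true))

∑ˢ-++ : ∀ a b F → ∑ˢ (a + b) F ≈ ∑ˢ a (λ A → ∑ˢ b (λ B → F (A Vec.++ B)))
∑ˢ-++ zero    b F = ≈-sym (+P-identityʳ _)
∑ˢ-++ (suc a) b F =
  ≈-trans (∑ˢ-suc (a + b) F) (≈-trans (+P-cong (∑ˢ-++ a b _) (∑ˢ-++ a b _)) (≈-sym (∑ˢ-suc a _)))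

private
  _≟ˢ_ : ∀ {k} (A B : Subset k) → Dec (A ≡ B)
  _≟ˢ_ = VecP.≡-dec Bool._≟_

∑ˢ-point : ∀ k (C : Subset k) (F : Subset k → Poly) → ∑ˢ k (λ B → if does (B ≟ˢ C) then F B else []) ≈ F C
∑ˢ-point zero    []          F = +P-identityʳ (F [])
∑ˢ-point (suc k) (false ∷ C) F =
  ≈-trans (∑ˢ-suc k _) (≈-trans (+P-cong (∑ˢ-point k C (F ∘ (false ∷_))) (∑-0 (subsets k))) (+P-identityʳ _))
∑ˢ-point (suc k) (true ∷ C)  F =
  ≈-trans (∑ˢ-suc k _) (+P-cong (∑-0 (subsets k)) (∑ˢ-point k C (F ∘ (true ∷_))))

∑ˢ-image : ∀ {a b} (f : Fin a ↔ Fin b) F → ∑ˢ a (F ∘ image f) ≈ ∑ˢ b F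
∑ˢ-image {a} {b} f F = begin
  ∑ˢ a (F ∘ image f)
    ≈⟨ ∑ˢ-cong a (λ A → ∑ˢ-point b (image f A) F) ⟨
  ∑ˢ a (λ A → ∑ˢ b (λ B → if does (B ≟ˢ image f A) then F B else []))
    ≈⟨ ∑-comm (subsets a) (subsets b) _ ⟩
  ∑ˢ b (λ B → ∑ˢ a (λ A → if does (B ≟ˢ image f A) then F B else []))
    ≈⟨ ∑ˢ-cong b (λ B → ∑ˢ-cong a λ A → ≈-reflexive (cong (if_then F B else []) (same-point A B))) ⟩
  ∑ˢ b (λ B → ∑ˢ a (λ A → if does (A ≟ˢ preimage f B) then F B else []))
    ≈⟨ ∑ˢ-cong b (λ B → ∑ˢ-point a (preimage f B) (λ _ → F B)) ⟩
  ∑ˢ b F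
    ∎
  where
  open ≈-Reasoning
  same-point : ∀ A B → does (B ≟ˢ image f A) ≡ does (A ≟ˢ preimage f B)
  same-point A B = does-⇔ (mk⇔ (λ B≡fA → trans (sym (preimage-image f A)) (cong (preimage f) (sym B≡fA)))
                                 (λ A≡f⁻¹B → trans (sym (image-preimage f B)) (cong (image f) (sym A≡f⁻¹B))))
                           (B ≟ˢ image f A) (A ≟ˢ preimage f B)

module ℕSum = CommMonoidSum ℕP.+-0-commutativeMonoid

∣∣≡countFin : ∀ {k} (A : Subset k) → ∣ A ∣ ≡ countFin k (lookup A)
∣∣≡countFin []         = refl
∣∣≡countFin (true ∷ A)  = cong suc (∣∣≡countFin A)
∣∣≡countFin (false ∷ A) = ∣∣≡countFin A

countFin≡sum : ∀ k P → countFin k P ≡ ℕSum.sum (𝟙 ∘ P)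
countFin≡sum zero    P = refl
countFin≡sum (suc k) P = cong (𝟙 (P zero) +_) (countFin≡sum k (P ∘ suc))

∣image∣ : ∀ {a b} (f : Fin a ↔ Fin b) A → ∣ image f A ∣ ≡ ∣ A ∣
∣image∣ {a} {b} f A = begin
  ∣ image f A ∣                             ≡⟨ ∣∣≡countFin (image f A) ⟩
  countFin b (lookup (image f A))           ≡⟨ countFin-cong b (VecP.lookup∘tabulate (lookup A ∘ from)) ⟩
  countFin b (lookup A ∘ from)              ≡⟨ countFin≡sum b _ ⟩
  ℕSum.sum (𝟙 ∘ lookup A ∘ from)            ≡⟨ ℕSum.∑-permute (𝟙 ∘ lookup A ∘ from) f ⟩
  ℕSum.sum (𝟙 ∘ lookup A ∘ from ∘ to)       ≡⟨ countFin≡sum a _ ⟨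
  countFin a (lookup A ∘ from ∘ to)         ≡⟨ countFin-cong a (cong (lookup A) ∘ strictlyInverseʳ) ⟩
  countFin a (lookup A)                     ≡⟨ ∣∣≡countFin A ⟨
  ∣ A ∣                                     ∎
  where
  open ≡-Reasoning
  open Inverse f

∣insertAt∣ : ∀ {k} (A : Subset k) e b → ∣ insertAt A e b ∣ ≡ 𝟙 b + ∣ A ∣
∣insertAt∣ A           zero    true  = refl
∣insertAt∣ A           zero    false = refl
∣insertAt∣ (true ∷ A)  (suc e) b     = trans (cong suc (∣insertAt∣ A e b)) (sym (ℕP.+-suc (𝟙 b) ∣ A ∣))
∣insertAt∣ (false ∷ A) (suc e) b     = ∣insertAt∣ A e b

image-⊤ : ∀ {a b} (f : Fin a ↔ Fin b) → image f ⊤ ≡ ⊤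
image-⊤ f = trans (VecP.tabulate-cong λ j → trans (VecP.lookup-replicate (Inverse.from f j) true)
                                                    (sym (VecP.lookup-replicate j true)))
                  (VecP.tabulate∘lookup ⊤)

insertAt-⊤ : ∀ {k} (e : Fin (suc k)) → insertAt (⊤ {k}) e true ≡ ⊤
insertAt-⊤ zero = refl
insertAt-⊤ {suc k} (suc e) = cong (true ∷_) (insertAt-⊤ e)

insertAt-⊤-false : ∀ {k} (e : Fin (suc k)) → insertAt (⊤ {k}) e false ≡ ∁ ⁅ e ⁆
insertAt-⊤-false {k} zero = cong (false ∷_) (sym (∁⊥ k))
  where
  ∁⊥ : ∀ k → ∁ (⊥ {k}) ≡ ⊤
  ∁⊥ zero    = refl
  ∁⊥ (suc k) = cong (true ∷_) (∁⊥ k)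
insertAt-⊤-false {suc k} (suc e) = cong (true ∷_) (insertAt-⊤-false e)

insertAt-⊥ : ∀ {k} (e : Fin (suc k)) → insertAt (⊥ {k}) e true ≡ ⁅ e ⁆
insertAt-⊥ zero = refl
insertAt-⊥ {suc k} (suc e) = cong (false ∷_) (insertAt-⊥ e)

-- Falling factorials and set partitions

guard : Bool → Poly → Poly
guard b p = if b then p else []

guard-cong : ∀ b {p r} → p ≈ r → guard b p ≈ guard b r
guard-cong true  p≈r = p≈r
guard-cong false p≈r = ≈-refl

guard-+P : ∀ b p r → (guard b p +P guard b r) ≈ guard b (p +P r)
guard-+P true  p r = ≈-refl
guard-+P false p r = ≈-refl

*P-guard : ∀ b p r → (r *P guard b p) ≈ guard b (r *P p)
*P-guard true  p r = ≈-refl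
*P-guard false p r = CommutativeRing.zeroʳ polyRing r

guard-∧ : ∀ a b p → guard (a ∧ b) p ≡ guard a (guard b p)
guard-∧ true  b p = refl
guard-∧ false b p = refl

∑-guard : ∀ {A : Set} (xs : List A) b (F : A → Poly) → ∑ xs (λ x → guard b (F x)) ≈ guard b (∑ xs F)
∑-guard xs true  F = ≈-refl
∑-guard xs false F = ∑-0 xs

∑ᶠ-guard : ∀ k b (F : Fin k → Poly) → ∑[ i < k ] guard b (F i) ≈ guard b (∑[ i < k ] F i)
∑ᶠ-guard zero    true  F = ≈-refl
∑ᶠ-guard zero    false F = ≈-refl
∑ᶠ-guard (suc k) b     F = ≈-trans (+P-cong ≈-refl (∑ᶠ-guard k b (F ∘ suc))) (guard-+P b (F zero) _)

∑ᶠ-point : ∀ k (j : Fin k) p → ∑[ i < k ] guard (j == i) p ≈ p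
∑ᶠ-point (suc k) zero    p = ≈-trans (+P-cong ≈-refl (≈-reflexive (sum-zero k))) (+P-identityʳ p)
  where
  sum-zero : ∀ k → ∑[ i < k ] guard (zero == suc i) p ≡ []
  sum-zero zero    = refl
  sum-zero (suc k) = sum-zero k
∑ᶠ-point (suc k) (suc j) p = ∑ᶠ-point k j p

constP-0 : constP 0ℤ ≈ []
constP-0 = fromCoeffs λ i j → zero-if (does (0 ℕ.≟ i) ∧ does (0 ℕ.≟ j))
  where
  zero-if : ∀ b → (if b then 0ℤ else 0ℤ) +ℤ 0ℤ ≡ 0ℤ
  zero-if true  = refl
  zero-if false = refl

constP-+ : ∀ a b → (constP a +P constP b) ≈ constP (a +ℤ b)
constP-+ a b = fromCoeffs λ i j → add-if (does (0 ℕ.≟ i) ∧ does (0 ℕ.≟ j))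
  where
  add-if : ∀ c → (if c then a else 0ℤ) +ℤ ((if c then b else 0ℤ) +ℤ 0ℤ) ≡ (if c then a +ℤ b else 0ℤ) +ℤ 0ℤ
  add-if true  = trans (cong (a +ℤ_) (ℤP.+-identityʳ b)) (sym (ℤP.+-identityʳ (a +ℤ b)))
  add-if false = refl

∑ᶠ-const : ∀ k p → ∑[ i < k ] p ≈ p *P constP (ℤ.+ k)
∑ᶠ-const zero    p = ≈-sym (≈-trans (*P-congˡ p constP-0) (CommutativeRing.zeroʳ polyRing p))
∑ᶠ-const (suc k) p = begin
  p +P ∑[ i < k ] p                 ≈⟨ +P-cong (≈-sym (CommutativeRing.*-identityʳ polyRing p)) (∑ᶠ-const k p) ⟩
  p *P 1P +P p *P constP (ℤ.+ k)     ≈⟨ CommutativeRing.distribˡ polyRing p 1P (constP (ℤ.+ k)) ⟨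
  p *P (1P +P constP (ℤ.+ k))        ≈⟨ *P-congˡ p (constP-+ 1ℤ (ℤ.+ k)) ⟩
  p *P constP (ℤ.+ suc k)            ∎
  where open ≈-Reasoning

fallingT-suc : ∀ k → (∑[ i < k ] fallingT k +P fallingT (suc k)) ≈ (tP *P fallingT k)
fallingT-suc k = begin
  ∑[ i < k ] p +P p *P (tP +P negP kP)  ≈⟨ +P-cong (∑ᶠ-const k p) ≈-refl ⟩
  p *P kP +P p *P (tP +P negP kP)       ≈⟨ regroup p kP tP ⟩
  tP *P p +P p *P (kP +P negP kP)       ≈⟨ +P-cong ≈-refl (*P-congˡ p (CommutativeRing.-‿inverseʳ polyRing kP)) ⟩
  tP *P p +P p *P []                    ≈⟨ +P-cong ≈-refl (CommutativeRing.zeroʳ polyRing p) ⟩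
  tP *P p +P []                         ≈⟨ +P-identityʳ _ ⟩
  tP *P p                               ∎
  where
  open ≈-Reasoning
  p kP : Poly
  p  = fallingT k
  kP = constP (ℤ.+ k)
  -- The ring solver does not know x - x = 0, so that step is done by hand.
  regroup : ∀ p c t → ((p *P c) +P (p *P (t +P negP c))) ≈ ((t *P p) +P (p *P (c +P negP c)))
  regroup = solve-∀ polyACR

Coarsens : ∀ {n} → SetPartition n → BoolRel n → Set
Coarsens (k , lab) R = ∀ u v → Holds R u v → lookup lab u ≡ lookup lab v

coarsens? : ∀ {n} (π : SetPartition n) R → Dec (Coarsens π R)
coarsens? (k , lab) R = FinP.all? λ u → FinP.all? λ v → (R u v Bool.≟ true) →-dec (lookup lab u Fin.≟ lookup lab v)

restrict : ∀ {n} → BoolRel (suc n) → BoolRel n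
restrict R u v = R (inject₁ u) (inject₁ v)

lastView : ∀ {n} (z : Fin (suc n)) → (∃ λ u → inject₁ u ≡ z) ⊎ z ≡ fromℕ n
lastView {zero}  zero    = inj₂ refl
lastView {suc n} zero    = inj₁ (zero , refl)
lastView {suc n} (suc z) with lastView z
... | inj₁ (u , refl) = inj₁ (suc u , refl)
... | inj₂ refl       = inj₂ refl

lookup-∷ʳ-inject₁ : ∀ {A : Set} {n} (v : Vec A n) x u → lookup (v Vec.∷ʳ x) (inject₁ u) ≡ lookup v u
lookup-∷ʳ-inject₁ (y ∷ v) x zero    = refl
lookup-∷ʳ-inject₁ (y ∷ v) x (suc u) = lookup-∷ʳ-inject₁ v x u

lookup-∷ʳ-last : ∀ {A : Set} {n} (v : Vec A n) x → lookup (v Vec.∷ʳ x) (fromℕ n) ≡ x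
lookup-∷ʳ-last []      x = refl
lookup-∷ʳ-last (y ∷ v) x = lookup-∷ʳ-last v x

coarsens-∷ʳ : ∀ {n k} (R : BoolRel (suc n)) → Symmetric (Holds R) → (lab : Vec (Fin k) n) (x : Fin k) →
              Coarsens (k , lab Vec.∷ʳ x) R ⇔
              (Coarsens (k , lab) (restrict R) × (∀ u → Holds R (inject₁ u) (fromℕ n) → lookup lab u ≡ x))
coarsens-∷ʳ {n} R sym-R lab x = mk⇔
  (λ c → (λ u v Ruv → trans (sym (lab′-inject₁ u)) (trans (c _ _ Ruv) (lab′-inject₁ v)))
       , (λ u Rul → trans (sym (lab′-inject₁ u)) (trans (c _ _ Rul) lab′-last)))
  (λ (c , c-last) u v Ruv → glue c c-last u v Ruv)
  where
  lab′ = lab Vec.∷ʳ x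
  lab′-inject₁ : ∀ u → lookup lab′ (inject₁ u) ≡ lookup lab u
  lab′-inject₁ = lookup-∷ʳ-inject₁ lab x
  lab′-last : lookup lab′ (fromℕ n) ≡ x
  lab′-last = lookup-∷ʳ-last lab x
  glue : Coarsens (_ , lab) (restrict R) → (∀ u → Holds R (inject₁ u) (fromℕ n) → lookup lab u ≡ x) →
         Coarsens (_ , lab′) R
  glue c c-last u v Ruv with lastView u | lastView v
  ... | inj₁ (u′ , refl) | inj₁ (v′ , refl) = trans (lab′-inject₁ u′) (trans (c u′ v′ Ruv) (sym (lab′-inject₁ v′)))
  ... | inj₁ (u′ , refl) | inj₂ refl        = trans (lab′-inject₁ u′) (trans (c-last u′ Ruv) (sym lab′-last))
  ... | inj₂ refl        | inj₁ (v′ , refl) = trans lab′-last (trans (sym (c-last v′ (sym-R Ruv))) (sym (lab′-inject₁ v′)))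
  ... | inj₂ refl        | inj₂ refl        = refl

countLeaders-suc : ∀ n (R : BoolRel (suc n)) →
  countLeaders (suc n) R ≡ countLeaders n (restrict R) + 𝟙 (not (anyFin n (λ u → R (inject₁ u) (fromℕ n))))
countLeaders-suc n R = trans (countFin-last n (isLeader (suc n) R))
  (cong₂ _+_ (countFin-cong n λ w → cong not (leader-inject₁ w)) (cong (𝟙 ∘ not) leader-last))
  where
  inject₁<last : ∀ z → toℕ (inject₁ z) < toℕ (fromℕ n)
  inject₁<last z = subst₂ _<_ (sym (FinP.toℕ-inject₁ z)) (sym (FinP.toℕ-fromℕ n)) (FinP.toℕ<n z)
  leader-inject₁ : ∀ w → anyFin (suc n) (λ z → (toℕ z <ᵇ toℕ (inject₁ w)) ∧ R z (inject₁ w))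
                       ≡ anyFin n (λ z → (toℕ z <ᵇ toℕ w) ∧ restrict R z w)
  leader-inject₁ w = trans (anyFin-last n (λ z → (toℕ z <ᵇ toℕ (inject₁ w)) ∧ R z (inject₁ w))) (trans (cong₂ _∨_
    (anyFin-cong n λ z → cong (_∧ restrict R z w) (cong₂ _<ᵇ_ (FinP.toℕ-inject₁ z) (FinP.toℕ-inject₁ w)))
    (cong (_∧ R (fromℕ n) (inject₁ w)) (≤⇒<ᵇfalse (ℕP.<⇒≤ (inject₁<last w)))))
    (BoolP.∨-identityʳ _))
  leader-last : anyFin (suc n) (λ z → (toℕ z <ᵇ toℕ (fromℕ n)) ∧ R z (fromℕ n))
              ≡ anyFin n (λ u → R (inject₁ u) (fromℕ n))
  leader-last = trans (anyFin-last n (λ z → (toℕ z <ᵇ toℕ (fromℕ n)) ∧ R z (fromℕ n))) (trans (cong₂ _∨_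
    (anyFin-cong n λ z → cong (_∧ R (inject₁ z) (fromℕ n)) (<⇒<ᵇ (inject₁<last z)))
    (cong (_∧ R (fromℕ n) (fromℕ n)) (≤⇒<ᵇfalse (ℕP.≤-refl {toℕ (fromℕ n)}))))
    (BoolP.∨-identityʳ _))

∑-tabulate : ∀ {A : Set} k (g : Fin k → A) F → ∑ (List.tabulate g) F ≈ ∑[ i < k ] F (g i)
∑-tabulate zero    g F = ≈-refl
∑-tabulate (suc k) g F = +P-cong ≈-refl (∑-tabulate k (g ∘ suc) F)

fallingTerm : ∀ {n} → BoolRel n → SetPartition n → Poly
fallingTerm R π = guard (does (coarsens? π R)) (fallingT (#blocks π))

-- Π (suc n) is concatMap extensions (Π n) by definition.
extensions : ∀ {n} → SetPartition n → List (SetPartition (suc n))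
extensions (k , lab) =
  List.map (λ i → k , lab Vec.∷ʳ i) (List.allFin k) ++ (suc k , Vec.map inject₁ lab Vec.∷ʳ fromℕ k) ∷ []

module _ {n : ℕ} (R : BoolRel (suc n)) (sym-R : Symmetric (Holds R)) where

  private
    last = fromℕ n

    ∑-extensions : ∀ k (lab : Vec (Fin k) n) → ∑ (extensions (k , lab)) (fallingTerm R)
      ≈ ∑[ i < k ] fallingTerm R (k , lab Vec.∷ʳ i) +P fallingTerm R (suc k , Vec.map inject₁ lab Vec.∷ʳ fromℕ k)
    ∑-extensions k lab = ≈-trans (∑-++ (List.map _ (List.allFin k)) _ (fallingTerm R))
      (+P-cong (≈-trans (≈-reflexive (∑-map _ (List.allFin k) (fallingTerm R))) (∑-tabulate k id _)) (+P-identityʳ _))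

  coarsens-map-inject₁ : ∀ {k} (lab : Vec (Fin k) n) →
    Coarsens (suc k , Vec.map inject₁ lab) (restrict R) ⇔ Coarsens (k , lab) (restrict R)
  coarsens-map-inject₁ lab = mk⇔
    (λ c u v Ruv → FinP.inject₁-injective (trans (sym (lookup-map u)) (trans (c u v Ruv) (lookup-map v))))
    (λ c u v Ruv → trans (lookup-map u) (trans (cong inject₁ (c u v Ruv)) (sym (lookup-map v))))
    where
    lookup-map : ∀ u → lookup (Vec.map inject₁ lab) u ≡ inject₁ (lookup lab u)
    lookup-map u = VecP.lookup-map u inject₁ lab

  module _ (unrelated : ∀ u → R (inject₁ u) last ≡ false) where

    ∑-extensions-unrelated : ∀ k (lab : Vec (Fin k) n) →
      ∑ (extensions (k , lab)) (fallingTerm R) ≈ tP *P fallingTerm (restrict R) (k , lab)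
    ∑-extensions-unrelated k lab = begin
      ∑ (extensions (k , lab)) (fallingTerm R)
        ≈⟨ ∑-extensions k lab ⟩
      ∑[ i < k ] fallingTerm R (k , lab Vec.∷ʳ i) +P fallingTerm R (suc k , Vec.map inject₁ lab Vec.∷ʳ fromℕ k)
        ≈⟨ +P-cong (∑ᶠ-cong λ i → ≈-reflexive (cong (λ b → guard b (fallingT k)) (old-block i)))
                   (≈-reflexive (cong (λ b → guard b (fallingT (suc k))) new-block)) ⟩
      ∑[ i < k ] guard ok (fallingT k) +P guard ok (fallingT (suc k))
        ≈⟨ +P-cong (∑ᶠ-guard k ok (λ _ → fallingT k)) ≈-refl ⟩
      guard ok (∑[ i < k ] fallingT k) +P guard ok (fallingT (suc k))
        ≈⟨ guard-+P ok _ _ ⟩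
      guard ok (∑[ i < k ] fallingT k +P fallingT (suc k))
        ≈⟨ guard-cong ok (fallingT-suc k) ⟩
      guard ok (tP *P fallingT k)
        ≈⟨ *P-guard ok (fallingT k) tP ⟨
      tP *P fallingTerm (restrict R) (k , lab)
        ∎
      where
      open ≈-Reasoning
      ok = does (coarsens? (k , lab) (restrict R))
      vacuous : ∀ {A : Set} u → Holds R (inject₁ u) last → A
      vacuous u Rul = ⊥-elim (true≢false (trans (sym Rul) (unrelated u)))
      old-block : ∀ i → does (coarsens? (k , lab Vec.∷ʳ i) R) ≡ ok
      old-block i = does-⇔ (mk⇔ (proj₁ ∘ Equivalence.to (coarsens-∷ʳ R sym-R lab i))
                                 (λ c → Equivalence.from (coarsens-∷ʳ R sym-R lab i) (c , λ u → vacuous u)))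
                           (coarsens? (k , lab Vec.∷ʳ i) R) (coarsens? (k , lab) (restrict R))
      new-block : does (coarsens? (suc k , Vec.map inject₁ lab Vec.∷ʳ fromℕ k) R) ≡ ok
      new-block = does-⇔ (mk⇔ (Equivalence.to (coarsens-map-inject₁ lab) ∘ proj₁ ∘ Equivalence.to new)
                               (λ c → Equivalence.from new (Equivalence.from (coarsens-map-inject₁ lab) c , λ u → vacuous u)))
                         (coarsens? (suc k , Vec.map inject₁ lab Vec.∷ʳ fromℕ k) R) (coarsens? (k , lab) (restrict R))
        where new = coarsens-∷ʳ R sym-R (Vec.map inject₁ lab) (fromℕ k)

  module _ (trans-R : Transitive (Holds R)) (u₀ : Fin n) (related : R (inject₁ u₀) last ≡ true) where

    ∑-extensions-related : ∀ k (lab : Vec (Fin k) n) →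
      ∑ (extensions (k , lab)) (fallingTerm R) ≈ fallingTerm (restrict R) (k , lab)
    ∑-extensions-related k lab = begin
      ∑ (extensions (k , lab)) (fallingTerm R)
        ≈⟨ ∑-extensions k lab ⟩
      ∑[ i < k ] fallingTerm R (k , lab Vec.∷ʳ i) +P fallingTerm R (suc k , Vec.map inject₁ lab Vec.∷ʳ fromℕ k)
        ≈⟨ +P-cong (∑ᶠ-cong λ i → ≈-reflexive (trans (cong (λ b → guard b (fallingT k)) (old-block i))
                                                       (guard-∧ ok (lookup lab u₀ == i) (fallingT k))))
                   (≈-reflexive (cong (λ b → guard b (fallingT (suc k))) new-block)) ⟩
      ∑[ i < k ] guard ok (guard (lookup lab u₀ == i) (fallingT k)) +P []
        ≈⟨ +P-identityʳ _ ⟩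
      ∑[ i < k ] guard ok (guard (lookup lab u₀ == i) (fallingT k))
        ≈⟨ ∑ᶠ-guard k ok _ ⟩
      guard ok (∑[ i < k ] guard (lookup lab u₀ == i) (fallingT k))
        ≈⟨ guard-cong ok (∑ᶠ-point k (lookup lab u₀) (fallingT k)) ⟩
      fallingTerm (restrict R) (k , lab)
        ∎
      where
      open ≈-Reasoning
      ok = does (coarsens? (k , lab) (restrict R))
      old-block : ∀ i → does (coarsens? (k , lab Vec.∷ʳ i) R) ≡ ok ∧ (lookup lab u₀ == i)
      old-block i = does-⇔ (mk⇔ (λ c → let (c↾ , c-last) = Equivalence.to old c in c↾ , c-last u₀ related)
                                 (λ (c↾ , u₀↦i) → Equivalence.from old (c↾ , λ u Rul →
                                   trans (c↾ u u₀ (trans-R Rul (sym-R related))) u₀↦i)))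
                           (coarsens? (k , lab Vec.∷ʳ i) R) (coarsens? (k , lab) (restrict R) ×-dec (lookup lab u₀ Fin.≟ i))
        where old = coarsens-∷ʳ R sym-R lab i
      new-block : does (coarsens? (suc k , Vec.map inject₁ lab Vec.∷ʳ fromℕ k) R) ≡ false
      new-block = dec-false (coarsens? (suc k , Vec.map inject₁ lab Vec.∷ʳ fromℕ k) R) λ c →
        FinP.fromℕ≢inject₁ (trans (sym (proj₂ (Equivalence.to new c) u₀ related)) (VecP.lookup-map u₀ inject₁ lab))
        where new = coarsens-∷ʳ R sym-R (Vec.map inject₁ lab) (fromℕ k)

-- The last vertex either starts a new class, and then joins one of the k blocks or a new one
-- (k t_(k) + t_(k+1) = t t_(k)), or it is related to an earlier vertex, whose block it must join.
∑-fallingTerm : ∀ n (R : BoolRel n) → Symmetric (Holds R) → Transitive (Holds R) →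
                ∑ (Π n) (fallingTerm R) ≈ tP ^P countLeaders n R
∑-fallingTerm zero    R sym-R trans-R = +P-identityʳ _
∑-fallingTerm (suc n) R sym-R trans-R with anyFin n (λ u → R (inject₁ u) (fromℕ n)) in last-related
... | false = begin
  ∑ (Π (suc n)) (fallingTerm R)                          ≈⟨ ∑-concatMap extensions (Π n) (fallingTerm R) ⟩
  ∑ (Π n) (λ π → ∑ (extensions π) (fallingTerm R))       ≈⟨ ∑-cong (Π n) (λ (k , lab) →
                                                              ∑-extensions-unrelated R sym-R unrelated k lab) ⟩
  ∑ (Π n) (λ π → tP *P fallingTerm (restrict R) π)       ≈⟨ *-distribˡ-∑ (Π n) tP _ ⟨
  tP *P ∑ (Π n) (fallingTerm (restrict R))               ≈⟨ *P-congˡ tP (∑-fallingTerm n (restrict R) sym-R trans-R) ⟩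
  tP *P tP ^P countLeaders n (restrict R)                ≡⟨ cong (tP ^P_) (trans (ℕP.+-comm 1 _) (sym leaders)) ⟩
  tP ^P countLeaders (suc n) R                           ∎
  where
  open ≈-Reasoning
  unrelated : ∀ u → R (inject₁ u) (fromℕ n) ≡ false
  unrelated u = ≢true⇒≡false λ Rul → true≢false (trans (sym (anyFin-intro n _ u Rul)) last-related)
  leaders : countLeaders (suc n) R ≡ countLeaders n (restrict R) + 1
  leaders = trans (countLeaders-suc n R) (cong (λ b → countLeaders n (restrict R) + 𝟙 (not b)) last-related)
... | true = begin
  ∑ (Π (suc n)) (fallingTerm R)                          ≈⟨ ∑-concatMap extensions (Π n) (fallingTerm R) ⟩
  ∑ (Π n) (λ π → ∑ (extensions π) (fallingTerm R))       ≈⟨ ∑-cong (Π n) (λ (k , lab) →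
                                                              ∑-extensions-related R sym-R trans-R u₀ related k lab) ⟩
  ∑ (Π n) (fallingTerm (restrict R))                     ≈⟨ ∑-fallingTerm n (restrict R) sym-R trans-R ⟩
  tP ^P countLeaders n (restrict R)                      ≡⟨ cong (tP ^P_) (sym leaders) ⟩
  tP ^P countLeaders (suc n) R                           ∎
  where
  open ≈-Reasoning
  witness = anyFin-witness n (λ u → R (inject₁ u) (fromℕ n)) last-related
  u₀ = proj₁ witness
  related = proj₂ witness
  leaders : countLeaders (suc n) R ≡ countLeaders n (restrict R)
  leaders = trans (countLeaders-suc n R)
    (trans (cong (λ b → countLeaders n (restrict R) + 𝟙 (not b)) last-related) (ℕP.+-identityʳ _))

-- The subgraph expansion of Z

1-qP : Poly
1-qP = 1P +P negP qP

weight : ∀ k → Subset k → Poly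
weight k A = (1-qP ^P ∣ A ∣) *P (qP ^P (k ∸ ∣ A ∣))

weight-insertAt-false : ∀ k A e → weight (suc k) (insertAt A e false) ≈ qP *P weight k A
weight-insertAt-false k A e rewrite ∣insertAt∣ A e false | ℕP.+-∸-assoc 1 (∣p∣≤n A) =
  x∙yz≈y∙xz (1-qP ^P ∣ A ∣) qP (qP ^P (k ∸ ∣ A ∣))

weight-insertAt-true : ∀ k A e → weight (suc k) (insertAt A e true) ≈ 1-qP *P weight k A
weight-insertAt-true k A e rewrite ∣insertAt∣ A e true = *P-assoc 1-qP (1-qP ^P ∣ A ∣) (qP ^P (k ∸ ∣ A ∣))

q+[1-q]≈1 : ∀ p → (qP *P p) +P (1-qP *P p) ≈ p
q+[1-q]≈1 p = begin
  qP *P p +P 1-qP *P p          ≈⟨ regroup qP p ⟩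
  (1P +P (qP +P negP qP)) *P p  ≈⟨ *P-cong (+P-cong (≈-refl {1P}) (CommutativeRing.-‿inverseʳ polyRing qP)) ≈-refl ⟩
  (1P +P []) *P p               ≈⟨ *P-cong (+P-identityʳ 1P) ≈-refl ⟩
  1P *P p                       ≈⟨ *P-identityˡ p ⟩
  p                             ∎
  where
  open ≈-Reasoning
  regroup : ∀ q p → ((q *P p) +P ((1P +P negP q) *P p)) ≈ ((1P +P (q +P negP q)) *P p)
  regroup = solve-∀ polyACR

disjoint : ∀ {k} → Subset k → (Fin k → Bool) → Bool
disjoint {k} A X = not (anyFin k (λ e → lookup A e ∧ X e))

∑ˢ-guard-*P : ∀ k (b : Subset k → Bool) (W : Subset k → Poly) p →
              ∑ˢ k (λ A → guard (b A) (p *P W A)) ≈ p *P ∑ˢ k (λ A → guard (b A) (W A))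
∑ˢ-guard-*P k b W p = ≈-trans (∑ˢ-cong k λ A → ≈-sym (*P-guard (b A) (W A) p)) (≈-sym (*-distribˡ-∑ (subsets k) p _))

-- Every edge outside X contributes a factor q + (1 - q) = 1.
q^count-expansion : ∀ k (X : Fin k → Bool) → qP ^P countFin k X ≈ ∑ˢ k (λ A → guard (disjoint A X) (weight k A))
q^count-expansion zero    X = ≈-sym (≈-trans (+P-identityʳ _) (*P-identityˡ 1P))
q^count-expansion (suc k) X = begin
  qP ^P countFin (suc k) X                                            ≈⟨ split (X zero) ⟩
  qP *P S +P guard (not (X zero)) (1-qP *P S)                          ≈⟨ +P-cong without-0 with-0 ⟨
  ∑ˢ k (λ A → guard (disjoint (false ∷ A) X) (weight (suc k) (false ∷ A))) +P
  ∑ˢ k (λ A → guard (disjoint (true ∷ A) X) (weight (suc k) (true ∷ A))) ≈⟨ ∑ˢ-suc k _ ⟨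
  ∑ˢ (suc k) (λ A → guard (disjoint A X) (weight (suc k) A))           ∎
  where
  open ≈-Reasoning
  X′ = X ∘ suc
  S  = ∑ˢ k (λ A → guard (disjoint A X′) (weight k A))
  split : ∀ b → qP ^P (𝟙 b + countFin k X′) ≈ qP *P S +P guard (not b) (1-qP *P S)
  split true  = ≈-trans (*P-congˡ qP (q^count-expansion k X′)) (≈-sym (+P-identityʳ _))
  split false = ≈-trans (q^count-expansion k X′) (≈-sym (q+[1-q]≈1 S))
  without-0 : ∑ˢ k (λ A → guard (disjoint A X′) (weight (suc k) (false ∷ A))) ≈ qP *P S
  without-0 = ≈-trans (∑ˢ-cong k λ A → guard-cong (disjoint A X′) (weight-insertAt-false k A zero))
                      (∑ˢ-guard-*P k (λ A → disjoint A X′) (weight k) qP)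
  guard-0 : ∀ A p → guard (not (X zero ∨ anyFin k (λ e → lookup A e ∧ X′ e))) p
                  ≡ guard (not (X zero)) (guard (disjoint A X′) p)
  guard-0 A p with X zero
  ... | true  = refl
  ... | false = refl
  with-0 : ∑ˢ k (λ A → guard (disjoint (true ∷ A) X) (weight (suc k) (true ∷ A))) ≈ guard (not (X zero)) (1-qP *P S)
  with-0 = begin
    ∑ˢ k (λ A → guard (disjoint (true ∷ A) X) (weight (suc k) (true ∷ A)))
      ≈⟨ ∑ˢ-cong k (λ A → ≈-trans (≈-reflexive (guard-0 A _))
                   (guard-cong (not (X zero)) (guard-cong (disjoint A X′) (weight-insertAt-true k A zero)))) ⟩
    ∑ˢ k (λ A → guard (not (X zero)) (guard (disjoint A X′) (1-qP *P weight k A)))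
      ≈⟨ ∑-guard (subsets k) (not (X zero)) _ ⟩
    guard (not (X zero)) (∑ˢ k (λ A → guard (disjoint A X′) (1-qP *P weight k A)))
      ≈⟨ guard-cong (not (X zero)) (∑ˢ-guard-*P k (λ A → disjoint A X′) (weight k) 1-qP) ⟩
    guard (not (X zero)) (1-qP *P S)
      ∎

cutEdge : (G : Graph) → SetPartition (n G) → Fin (m G) → Bool
cutEdge G (k , lab) e = not (lookup lab (proj₁ (ends G e)) == lookup lab (proj₂ (ends G e)))

disjoint-cut≡coarsens : ∀ G A π → disjoint A (cutEdge G π) ≡ does (coarsens? π (connected G A))
disjoint-cut≡coarsens G A (k , lab) = bool-ext
  (λ d → dec-true (coarsens? (k , lab) (connected G A)) λ u v c →
    sym (==⇒≡ _ _ (trans (sym (connected⇒invariant G A c _ (same-block-invariant d (lookup lab u)))) (==-refl (lookup lab u)))))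
  (λ ok → cong not (anyFin-false (m G) _ λ e → uncut e (does⇒ (coarsens? (k , lab) (connected G A)) ok)))
  where
  same-block-invariant : disjoint A (cutEdge G (k , lab)) ≡ true → ∀ i → Invariant G A (λ z → lookup lab z == i)
  same-block-invariant d i e Ae = cong (_== i) uncut-edge
    where
    uncut-edge : lookup lab (proj₁ (ends G e)) ≡ lookup lab (proj₂ (ends G e))
    uncut-edge with lookup lab (proj₁ (ends G e)) == lookup lab (proj₂ (ends G e)) in same
    ... | true  = ==⇒≡ _ _ same
    ... | false = ⊥-elim (true≢false (trans (sym d) (cong not (anyFin-intro (m G) _ e (∧-true-intro Ae (cong not same))))))
  uncut : ∀ e → Coarsens (k , lab) (connected G A) → lookup A e ∧ cutEdge G (k , lab) e ≡ false
  uncut e c with lookup A e in Ae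
  ... | false = refl
  ... | true  rewrite c _ _ (connected-edge G A e Ae) = cong not (==-refl (lookup lab (proj₂ (ends G e))))

Z-subgraph-expansion : ∀ G → Z G ≈ ∑ˢ (m G) (λ A → tP ^P compS G A *P weight (m G) A)
Z-subgraph-expansion G = begin
  Z G
    ≈⟨ ∑-cong (Π (n G)) expand-cut ⟩
  ∑ (Π (n G)) (λ π → ∑ˢ (m G) (λ A → weight (m G) A *P fallingTerm (connected G A) π))
    ≈⟨ ∑-comm (Π (n G)) (subsets (m G)) _ ⟩
  ∑ˢ (m G) (λ A → ∑ (Π (n G)) (λ π → weight (m G) A *P fallingTerm (connected G A) π))
    ≈⟨ ∑ˢ-cong (m G) (λ A → ≈-trans (≈-sym (*-distribˡ-∑ (Π (n G)) (weight (m G) A) _))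
         (*P-congˡ (weight (m G) A) (∑-fallingTerm (n G) (connected G A) (connected-sym G A) (connected-trans G A)))) ⟩
  ∑ˢ (m G) (λ A → weight (m G) A *P tP ^P countLeaders (n G) (connected G A))
    ≈⟨ ∑ˢ-cong (m G) (λ A → ≈-trans (*P-comm (weight (m G) A) _)
         (≈-reflexive (cong (λ c → tP ^P c *P weight (m G) A) (sym (compS≡countLeaders G A))))) ⟩
  ∑ˢ (m G) (λ A → tP ^P compS G A *P weight (m G) A)
    ∎
  where
  open ≈-Reasoning
  expand-cut : ∀ π → qP ^P cut G π *P fallingT (#blocks π)
                   ≈ ∑ˢ (m G) (λ A → weight (m G) A *P fallingTerm (connected G A) π)
  expand-cut π = begin
    qP ^P cut G π *P f
      ≈⟨ *P-cong (≈-trans (≈-reflexive (cong (qP ^P_) (countᵇ-tabulate (m G) _ id)))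
                          (q^count-expansion (m G) (cutEdge G π))) ≈-refl ⟩
    ∑ˢ (m G) (λ A → guard (disjoint A (cutEdge G π)) (weight (m G) A)) *P f
      ≈⟨ *P-comm _ f ⟩
    f *P ∑ˢ (m G) (λ A → guard (disjoint A (cutEdge G π)) (weight (m G) A))
      ≈⟨ *-distribˡ-∑ (subsets (m G)) f _ ⟩
    ∑ˢ (m G) (λ A → f *P guard (disjoint A (cutEdge G π)) (weight (m G) A))
      ≈⟨ ∑ˢ-cong (m G) (λ A → let d = disjoint A (cutEdge G π) ; w = weight (m G) A in
           ≈-trans (*P-guard d w f) (≈-trans (guard-cong d (*P-comm f w)) (≈-sym (*P-guard d f w)))) ⟩
    ∑ˢ (m G) (λ A → weight (m G) A *P guard (disjoint A (cutEdge G π)) f)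
      ≈⟨ ∑ˢ-cong (m G) (λ A → ≈-reflexive (cong (λ b → weight (m G) A *P guard b f) (disjoint-cut≡coarsens G A π))) ⟩
    ∑ˢ (m G) (λ A → weight (m G) A *P fallingTerm (connected G A) π)
      ∎
    where f = fallingT (#blocks π)

-- Z̃ as a function of the cycle matroid

Zₘ : ∀ {k} → Matroid k → Poly
Zₘ {k} ρ = ∑ˢ k (λ A → tP ^P (ρ ⊤ ∸ ρ A) *P weight k A)

Dₘ : ∀ {k} → Matroid k → Poly
Dₘ {k} ρ = 1-qP ^P ρ ⊤ *P qP ^P (k ∸ ρ ⊤)

module _ {a b} (ρ : Matroid a) (ρ′ : Matroid b) (ρ≃ρ′ : ρ ≃M ρ′) where

  private
    f = proj₁ ρ≃ρ′
    ρ′∘image≗ρ = proj₂ ρ≃ρ′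

    a≡b : a ≡ b
    a≡b = ↔⇒≡ f

    ρ′⊤≡ρ⊤ : ρ′ ⊤ ≡ ρ ⊤
    ρ′⊤≡ρ⊤ = trans (cong ρ′ (sym (image-⊤ f))) (ρ′∘image≗ρ ⊤)

  Zₘ-≃ : Zₘ ρ ≈ Zₘ ρ′
  Zₘ-≃ = ≈-trans (∑ˢ-cong a λ A → ≈-reflexive (cong₂ _*P_
      (cong (tP ^P_) (sym (cong₂ _∸_ ρ′⊤≡ρ⊤ (ρ′∘image≗ρ A))))
      (cong₂ (λ k c → 1-qP ^P c *P qP ^P (k ∸ c)) a≡b (sym (∣image∣ f A)))))
    (∑ˢ-image f (λ B → tP ^P (ρ′ ⊤ ∸ ρ′ B) *P weight b B))

  Dₘ-≃ : Dₘ ρ ≈ Dₘ ρ′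
  Dₘ-≃ = ≈-reflexive (cong₂ (λ k r → 1-qP ^P r *P qP ^P (k ∸ r)) a≡b (sym ρ′⊤≡ρ⊤))

∸-∸-cancel : ∀ {n c x} → c ≤ x → x ≤ n → (n ∸ c) ∸ (n ∸ x) ≡ x ∸ c
∸-∸-cancel {n}     {zero}  {x}     _         x≤n       = ℕP.m∸[m∸n]≡n x≤n
∸-∸-cancel {suc n} {suc c} {suc x} (s≤s c≤x) (s≤s x≤n) = ∸-∸-cancel c≤x x≤n

^P-+ : ∀ p a b → p ^P (a + b) ≈ p ^P a *P p ^P b
^P-+ p zero    b = ≈-sym (*P-identityˡ _)
^P-+ p (suc a) b = ≈-trans (*P-congˡ p (^P-+ p a b)) (≈-sym (*P-assoc p (p ^P a) (p ^P b)))

Z≈t^c*Zₘ : ∀ G → Z G ≈ tP ^P c G *P Zₘ M[ G ]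
Z≈t^c*Zₘ G = begin
  Z G                                                       ≈⟨ Z-subgraph-expansion G ⟩
  ∑ˢ (m G) (λ A → tP ^P compS G A *P weight (m G) A)         ≈⟨ ∑ˢ-cong (m G) split-components ⟩
  ∑ˢ (m G) (λ A → tP ^P c G *P (tP ^P (M[ G ] ⊤ ∸ M[ G ] A) *P weight (m G) A))
                                                            ≈⟨ *-distribˡ-∑ (subsets (m G)) (tP ^P c G) _ ⟨
  tP ^P c G *P Zₘ M[ G ]                                     ∎
  where
  open ≈-Reasoning
  -- c(A) = c(G) + (ρ(E) - ρ(A)), as c(G) ≤ c(A) ≤ n(G).
  split-components : ∀ A → tP ^P compS G A *P weight (m G) A
                         ≈ tP ^P c G *P (tP ^P (M[ G ] ⊤ ∸ M[ G ] A) *P weight (m G) A)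
  split-components A = ≈-trans (*P-cong (≈-trans (≈-reflexive (cong (tP ^P_) components)) (^P-+ tP (c G) _)) ≈-refl)
                               (*P-assoc (tP ^P c G) _ _)
    where
    c≤cA : c G ≤ compS G A
    c≤cA = compS-antitone G A ⊤ λ e _ → VecP.lookup-replicate e true
    components : compS G A ≡ c G + ((n G ∸ c G) ∸ (n G ∸ compS G A))
    components = trans (sym (ℕP.m+[n∸m]≡n c≤cA))
                       (cong (c G +_) (sym (∸-∸-cancel c≤cA (compS≤n G A))))

denominator≈t^c*Dₘ : ∀ G → tP ^P c G *P 1-qP ^P r G *P qP ^P s G ≈ tP ^P c G *P Dₘ M[ G ]
denominator≈t^c*Dₘ G = ≈-trans (*P-assoc (tP ^P c G) _ _)
  (≈-reflexive (cong (λ e → tP ^P c G *P (1-qP ^P r G *P qP ^P e)) (+-∸-∸ (m G) (compS≤n G ⊤))))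
  where
  +-∸-∸ : ∀ m {c n} → c ≤ n → (m + c) ∸ n ≡ m ∸ (n ∸ c)
  +-∸-∸ m {zero}  {n}     _         = cong (_∸ n) (ℕP.+-identityʳ m)
  +-∸-∸ m {suc c} {suc n} (s≤s c≤n) = trans (cong (_∸ suc n) (ℕP.+-suc m c)) (+-∸-∸ m c≤n)

infix 4 _≋_ _⇝_

_≋_ : Frac → Frac → Set
f ≋ g = num f *P den g ≈ num g *P den f

-- Without cancellation _≈F_ is not transitive, so fractions are compared through a common factor.
record _⇝_ (f g : Frac) : Set where
  field
    factor : Poly
    num≈   : num f ≈ factor *P num g
    den≈   : den f ≈ factor *P den g
open _⇝_

private
  cross : ∀ k k′ x y → (k *P x) *P (k′ *P y) ≈ (k *P k′) *P (x *P y)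
  cross = solve-∀ polyACR

⇝-≋ : ∀ {f f′ g g′} → f ⇝ g → f′ ⇝ g′ → g ≋ g′ → f ≋ f′
⇝-≋ {f} {f′} {g} {g′} f⇝g f′⇝g′ g≋g′ = begin
  num f *P den f′                    ≈⟨ *P-cong (num≈ f⇝g) (den≈ f′⇝g′) ⟩
  (k *P num g) *P (k′ *P den g′)     ≈⟨ cross k k′ (num g) (den g′) ⟩
  (k *P k′) *P (num g *P den g′)     ≈⟨ *P-congˡ (k *P k′) g≋g′ ⟩
  (k *P k′) *P (num g′ *P den g)     ≈⟨ *P-cong (*P-comm k k′) ≈-refl ⟩
  (k′ *P k) *P (num g′ *P den g)     ≈⟨ cross k′ k (num g′) (den g) ⟨
  (k′ *P num g′) *P (k *P den g)     ≈⟨ *P-cong (num≈ f′⇝g′) (den≈ f⇝g) ⟨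
  num f′ *P den f                    ∎
  where
  open ≈-Reasoning
  k  = factor f⇝g
  k′ = factor f′⇝g′

⇝-*F : ∀ {f f′ g g′} → f ⇝ g → f′ ⇝ g′ → (f *F f′) ⇝ (g *F g′)
⇝-*F {f} {f′} {g} {g′} f⇝g f′⇝g′ = record
  { factor = k *P k′
  ; num≈   = ≈-trans (*P-cong (num≈ f⇝g) (num≈ f′⇝g′)) (cross k k′ (num g) (num g′))
  ; den≈   = ≈-trans (*P-cong (den≈ f⇝g) (den≈ f′⇝g′)) (cross k k′ (den g) (den g′))
  }
  where
  k  = factor f⇝g
  k′ = factor f′⇝g′

⇝-+F : ∀ {f f′ g g′} → f ⇝ g → f′ ⇝ g′ → (f +F f′) ⇝ (g +F g′)
⇝-+F {f} {f′} {g} {g′} f⇝g f′⇝g′ = record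
  { factor = k *P k′
  ; num≈   = ≈-trans (+P-cong (*P-cong (num≈ f⇝g) (den≈ f′⇝g′)) (*P-cong (num≈ f′⇝g′) (den≈ f⇝g)))
                     (cross-sum k k′ (num g) (den g′) (num g′) (den g))
  ; den≈   = ≈-trans (*P-cong (den≈ f⇝g) (den≈ f′⇝g′)) (cross k k′ (den g) (den g′))
  }
  where
  k  = factor f⇝g
  k′ = factor f′⇝g′
  cross-sum : ∀ k k′ a b′ a′ b → (k *P a) *P (k′ *P b′) +P (k′ *P a′) *P (k *P b) ≈ (k *P k′) *P (a *P b′ +P a′ *P b)
  cross-sum = solve-∀ polyACR

⇝-cong : ∀ {f x y x′ y′} → f ⇝ (x / y) → x ≈ x′ → y ≈ y′ → f ⇝ (x′ / y′)
⇝-cong f⇝g x≈x′ y≈y′ = record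
  { factor = factor f⇝g
  ; num≈   = ≈-trans (num≈ f⇝g) (*P-congˡ (factor f⇝g) x≈x′)
  ; den≈   = ≈-trans (den≈ f⇝g) (*P-congˡ (factor f⇝g) y≈y′)
  }

Ψ : ∀ {k} → Matroid k → Frac
Ψ ρ = Zₘ ρ / Dₘ ρ

Z̃⇝Ψ : ∀ G → Z̃ G ⇝ Ψ M[ G ]
Z̃⇝Ψ G = record { factor = tP ^P c G ; num≈ = Z≈t^c*Zₘ G ; den≈ = denominator≈t^c*Dₘ G }

Z̃⇝Ψ-≃ : ∀ {k} G (M : Matroid k) → M[ G ] ≃M M → Z̃ G ⇝ Ψ M
Z̃⇝Ψ-≃ G M G≃M = ⇝-cong (Z̃⇝Ψ G) (Zₘ-≃ M[ G ] M G≃M) (Dₘ-≃ M[ G ] M G≃M)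

-- Deletion, contraction and direct sums of matroids

-- Only the rank axioms the argument needs.
record IsRank {k} (ρ : Matroid k) : Set where
  field
    monotone    : ∀ {A B} → A ⊆ B → ρ A ≤ ρ B
    subcardinal : ∀ A → ρ A ≤ ∣ A ∣

IsRank-cong : ∀ {k} {ρ ρ′ : Matroid k} → (∀ S → ρ S ≡ ρ′ S) → IsRank ρ → IsRank ρ′
IsRank-cong ρ≗ρ′ rank = record
  { monotone    = λ {A} {B} A⊆B → subst₂ _≤_ (ρ≗ρ′ A) (ρ≗ρ′ B) (monotone A⊆B)
  ; subcardinal = λ A → subst (_≤ ∣ A ∣) (ρ≗ρ′ A) (subcardinal A)
  }
  where open IsRank rank

M[]-isRank : ∀ G → IsRank M[ G ]
M[]-isRank G = record
  { monotone    = λ {A} {B} A⊆B → ℕP.∸-monoʳ-≤ (n G) (compS-antitone G A B λ e Ae →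
                    VecP.[]=⇒lookup (A⊆B (VecP.lookup⇒[]= e A Ae)))
  ; subcardinal = λ A → ℕP.m≤n+o⇒m∸n≤o (n G) (compS G A) (subst (n G ≤_) (ℕP.+-comm ∣ A ∣ _) (rank-bound (ends G) A))
  }

∸-pred : ∀ x {y} → 1 ≤ y → (x ∸ 1) ∸ (y ∸ 1) ≡ x ∸ y
∸-pred x {suc y} _ = ℕP.∸-+-assoc x 1 y

module _ {k} {ρ : Matroid (suc k)} (rank : IsRank ρ) (e : Fin (suc k)) where

  open IsRank rank

  private
    ρ-delete-⊤ : ¬ IsColoop ρ e → ρ (insertAt ⊤ e false) ≡ ρ ⊤
    ρ-delete-⊤ ¬coloop = ℕP.≤-antisym (monotone (λ _ → FinSubsetP.∈⊤))
      (ℕP.≮⇒≥ λ smaller → ¬coloop (subst (λ r → r < ρ ⊤) (cong ρ (insertAt-⊤-false e)) smaller))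

    ρ⊤≤k : ¬ IsColoop ρ e → ρ ⊤ ≤ k
    ρ⊤≤k ¬coloop = subst₂ _≤_ (ρ-delete-⊤ ¬coloop) (trans (∣insertAt∣ ⊤ e false) (FinSubsetP.∣⊤∣≡n k))
                               (subcardinal (insertAt ⊤ e false))

    ρ⁅e⁆≡1 : ¬ IsLoop ρ e → ρ ⁅ e ⁆ ≡ 1
    ρ⁅e⁆≡1 ¬loop = ℕP.≤-antisym (subst (ρ ⁅ e ⁆ ≤_) (FinSubsetP.∣⁅x⁆∣≡1 e) (subcardinal ⁅ e ⁆)) (ℕP.n≢0⇒n>0 ¬loop)

    ρ-contract≥1 : ¬ IsLoop ρ e → ∀ A → 1 ≤ ρ (insertAt A e true)
    ρ-contract≥1 ¬loop A = subst (_≤ ρ (insertAt A e true)) (ρ⁅e⁆≡1 ¬loop) (monotone e∈)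
      where
      e∈ : ⁅ e ⁆ ⊆ insertAt A e true
      e∈ x∈⁅e⁆ rewrite FinSubsetP.x∈⁅y⁆⇒x≡y e x∈⁅e⁆ = VecP.lookup⇒[]= e _ (VecP.insertAt-lookup A e true)

  Dₘ-delete : ¬ IsColoop ρ e → Dₘ ρ ≈ qP *P Dₘ (ρ ∖ₘ e)
  Dₘ-delete ¬coloop rewrite ρ-delete-⊤ ¬coloop | ℕP.+-∸-assoc 1 (ρ⊤≤k ¬coloop) =
    x∙yz≈y∙xz (1-qP ^P ρ ⊤) qP (qP ^P (k ∸ ρ ⊤))

  Dₘ-contract : ¬ IsLoop ρ e → Dₘ ρ ≈ 1-qP *P Dₘ (ρ /ₘ e)
  Dₘ-contract ¬loop rewrite insertAt-⊤ e | ρ⁅e⁆≡1 ¬loop =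
    peel (ρ ⊤) (subst (λ r → 1 ≤ ρ r) (insertAt-⊤ e) (ρ-contract≥1 ¬loop ⊤))
    where
    peel : ∀ r → 1 ≤ r → 1-qP ^P r *P qP ^P (suc k ∸ r) ≈ 1-qP *P (1-qP ^P (r ∸ 1) *P qP ^P (k ∸ (r ∸ 1)))
    peel (suc r) _ = *P-assoc 1-qP (1-qP ^P r) (qP ^P (k ∸ r))

  Zₘ-deleteContract : IsLink ρ e → Zₘ ρ ≈ qP *P Zₘ (ρ ∖ₘ e) +P 1-qP *P Zₘ (ρ /ₘ e)
  Zₘ-deleteContract (¬loop , ¬coloop) = begin
    Zₘ ρ
      ≈⟨ ∑ˢ-insertAt k e _ ⟩
    ∑ˢ k (λ A → term (insertAt A e false)) +P ∑ˢ k (λ A → term (insertAt A e true))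
      ≈⟨ +P-cong (∑ˢ-cong k deleted) (∑ˢ-cong k contracted) ⟩
    ∑ˢ k (λ A → qP *P termₘ (ρ ∖ₘ e) A) +P ∑ˢ k (λ A → 1-qP *P termₘ (ρ /ₘ e) A)
      ≈⟨ +P-cong (*-distribˡ-∑ (subsets k) qP _) (*-distribˡ-∑ (subsets k) 1-qP _) ⟨
    qP *P Zₘ (ρ ∖ₘ e) +P 1-qP *P Zₘ (ρ /ₘ e)
      ∎
    where
    open ≈-Reasoning
    term : Subset (suc k) → Poly
    term A = tP ^P (ρ ⊤ ∸ ρ A) *P weight (suc k) A
    termₘ : Matroid k → Subset k → Poly
    termₘ ρ′ A = tP ^P (ρ′ ⊤ ∸ ρ′ A) *P weight k A
    deleted : ∀ A → term (insertAt A e false) ≈ qP *P termₘ (ρ ∖ₘ e) A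
    deleted A rewrite ρ-delete-⊤ ¬coloop = let t = tP ^P (ρ ⊤ ∸ ρ (insertAt A e false)) in
      ≈-trans (*P-congˡ t (weight-insertAt-false k A e)) (x∙yz≈y∙xz t qP (weight k A))
    contracted : ∀ A → term (insertAt A e true) ≈ 1-qP *P termₘ (ρ /ₘ e) A
    contracted A rewrite insertAt-⊤ e | ρ⁅e⁆≡1 ¬loop | ∸-pred (ρ ⊤) (ρ-contract≥1 ¬loop A) =
      let t = tP ^P (ρ ⊤ ∸ ρ (insertAt A e true)) in
      ≈-trans (*P-congˡ t (weight-insertAt-true k A e)) (x∙yz≈y∙xz t 1-qP (weight k A))

take-⊤ : ∀ a b → Vec.take a (⊤ {a + b}) ≡ ⊤
take-⊤ zero    b = refl
take-⊤ (suc a) b = cong (true ∷_) (take-⊤ a b)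

drop-⊤ : ∀ a b → Vec.drop a (⊤ {a + b}) ≡ ⊤
drop-⊤ zero    b = refl
drop-⊤ (suc a) b = drop-⊤ a b

∣++∣ : ∀ {a b} (A : Subset a) (B : Subset b) → ∣ A Vec.++ B ∣ ≡ ∣ A ∣ + ∣ B ∣
∣++∣ []          B = refl
∣++∣ (true ∷ A)  B = cong suc (∣++∣ A B)
∣++∣ (false ∷ A) B = ∣++∣ A B

∸-+-distrib : ∀ {x₁ x₂ y₁ y₂} → y₁ ≤ x₁ → y₂ ≤ x₂ → (x₁ + x₂) ∸ (y₁ + y₂) ≡ (x₁ ∸ y₁) + (x₂ ∸ y₂)
∸-+-distrib {x₁} {x₂} {y₁} {y₂} y₁≤x₁ y₂≤x₂ = trans (sym (ℕP.∸-+-assoc (x₁ + x₂) y₁ y₂))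
  (trans (cong (_∸ y₂) (ℕP.+-∸-comm x₂ y₁≤x₁)) (ℕP.+-∸-assoc (x₁ ∸ y₁) y₂≤x₂))

module _ {a b} {ρ₁ : Matroid a} {ρ₂ : Matroid b} (rank₁ : IsRank ρ₁) (rank₂ : IsRank ρ₂) where

  private
    ρ≤ρ⊤ : ∀ {k} {ρ : Matroid k} → IsRank ρ → ∀ A → ρ A ≤ ρ ⊤
    ρ≤ρ⊤ rank A = IsRank.monotone rank (λ _ → FinSubsetP.∈⊤)

    ρ⊤≤k : ∀ {k} {ρ : Matroid k} → IsRank ρ → ρ ⊤ ≤ k
    ρ⊤≤k {k} {ρ} rank = subst (ρ ⊤ ≤_) (FinSubsetP.∣⊤∣≡n k) (IsRank.subcardinal rank ⊤)

    rearrange : ∀ a₁ a₂ b₁ b₂ c₁ c₂ → (a₁ *P a₂) *P ((b₁ *P b₂) *P (c₁ *P c₂)) ≈ (a₁ *P (b₁ *P c₁)) *P (a₂ *P (b₂ *P c₂))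
    rearrange = solve-∀ polyACR

  Dₘ-⊕ : Dₘ (ρ₁ ⊕ ρ₂) ≈ Dₘ ρ₁ *P Dₘ ρ₂
  Dₘ-⊕ rewrite take-⊤ a b | drop-⊤ a b | ∸-+-distrib (ρ⊤≤k rank₁) (ρ⊤≤k rank₂) =
    ≈-trans (*P-cong (^P-+ 1-qP (ρ₁ ⊤) (ρ₂ ⊤)) (^P-+ qP (a ∸ ρ₁ ⊤) (b ∸ ρ₂ ⊤)))
            (interchange (1-qP ^P ρ₁ ⊤) (1-qP ^P ρ₂ ⊤) (qP ^P (a ∸ ρ₁ ⊤)) (qP ^P (b ∸ ρ₂ ⊤)))
    where open CommSemigroupProperties (CommutativeRing.*-commutativeSemigroup polyRing) using (interchange)

  Zₘ-⊕ : Zₘ (ρ₁ ⊕ ρ₂) ≈ Zₘ ρ₁ *P Zₘ ρ₂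
  Zₘ-⊕ = begin
    Zₘ (ρ₁ ⊕ ρ₂)                            ≈⟨ ∑ˢ-++ a b _ ⟩
    ∑ˢ a (λ A → ∑ˢ b (λ B → term (ρ₁ ⊕ ρ₂) (A Vec.++ B)))
                                            ≈⟨ ∑ˢ-cong a (λ A → ∑ˢ-cong b (λ B → term-++ A B)) ⟩
    ∑ˢ a (λ A → ∑ˢ b (λ B → term ρ₁ A *P term ρ₂ B))
                                            ≈⟨ ∑ˢ-cong a (λ A → *-distribˡ-∑ (subsets b) (term ρ₁ A) (term ρ₂)) ⟨
    ∑ˢ a (λ A → term ρ₁ A *P Zₘ ρ₂)          ≈⟨ *-distribʳ-∑ (subsets a) (Zₘ ρ₂) (term ρ₁) ⟨
    Zₘ ρ₁ *P Zₘ ρ₂                          ∎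
    where
    open ≈-Reasoning
    term : ∀ {k} → Matroid k → Subset k → Poly
    term {k} ρ A = tP ^P (ρ ⊤ ∸ ρ A) *P weight k A
    term-++ : ∀ A B → term (ρ₁ ⊕ ρ₂) (A Vec.++ B) ≈ term ρ₁ A *P term ρ₂ B
    term-++ A B rewrite take-⊤ a b | drop-⊤ a b | take-++ a A B | drop-++ a A B | ∣++∣ A B
                      | ∸-+-distrib (ρ≤ρ⊤ rank₁ A) (ρ≤ρ⊤ rank₂ B) | ∸-+-distrib (∣p∣≤n A) (∣p∣≤n B) =
      ≈-trans (*P-cong (^P-+ tP (ρ₁ ⊤ ∸ ρ₁ A) (ρ₂ ⊤ ∸ ρ₂ B)) (*P-cong (^P-+ 1-qP ∣ A ∣ ∣ B ∣) (^P-+ qP (a ∸ ∣ A ∣) (b ∸ ∣ B ∣))))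
              (rearrange (tP ^P (ρ₁ ⊤ ∸ ρ₁ A)) (tP ^P (ρ₂ ⊤ ∸ ρ₂ B)) (1-qP ^P ∣ A ∣) (1-qP ^P ∣ B ∣)
                         (qP ^P (a ∸ ∣ A ∣)) (qP ^P (b ∸ ∣ B ∣)))

-- Graphic matroids

compS-⊥ : ∀ G → compS G ⊥ ≡ n G
compS-⊥ G = ℕP.≤-antisym (compS≤n G ⊥) (subst (λ x → n G ≤ x + compS G ⊥) (FinSubsetP.∣⊥∣≡0 (m G)) (rank-bound (ends G) ⊥))

module _ {nv k} (ends′ : Fin (suc k) → Fin nv × Fin nv) (e : Fin (suc k)) where

  private
    G = graph nv (suc k) ends′

  M[]-deleteEdge : ∀ S → M[ deleteEdge ends′ e ] S ≡ (M[ G ] ∖ₘ e) S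
  M[]-deleteEdge S = cong (nv ∸_) (sym (compS-deleteEdge ends′ e S))

  M[]-contractEdge : ∀ S → M[ contractEdge ends′ e ] S ≡ (M[ G ] /ₘ e) S
  M[]-contractEdge S = begin
    nv ∸ compS (contractEdge ends′ e) S                           ≡⟨ cong (nv ∸_) (compS-contractEdge ends′ e S) ⟩
    nv ∸ (compS G (insertAt S e true) + 𝟙 (nonLoop ends′ e))      ≡⟨ ℕP.∸-+-assoc nv (compS G (insertAt S e true)) _ ⟨
    nv ∸ compS G (insertAt S e true) ∸ 𝟙 (nonLoop ends′ e)        ≡⟨ cong (nv ∸ compS G (insertAt S e true) ∸_) ρ⁅e⁆ ⟨
    nv ∸ compS G (insertAt S e true) ∸ M[ G ] ⁅ e ⁆               ∎
    where
    open ≡-Reasoning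
    -- With no other edges present, contracting e leaves nv components.
    ρ⁅e⁆ : M[ G ] ⁅ e ⁆ ≡ 𝟙 (nonLoop ends′ e)
    ρ⁅e⁆ = begin
      nv ∸ compS G ⁅ e ⁆          ≡⟨ cong (λ A → nv ∸ compS G A) (insertAt-⊥ e) ⟨
      nv ∸ c₁                     ≡⟨ cong (_∸ c₁) (trans (sym (compS-⊥ (contractEdge ends′ e))) (compS-contractEdge ends′ e ⊥)) ⟩
      c₁ + 𝟙 (nonLoop ends′ e) ∸ c₁ ≡⟨ ℕP.m+n∸m≡n c₁ _ ⟩
      𝟙 (nonLoop ends′ e)         ∎
      where c₁ = compS G (insertAt ⊥ e true)

M[]-disjointUnion : ∀ G₁ G₂ S → M[ disjointUnion G₁ G₂ ] S ≡ (M[ G₁ ] ⊕ M[ G₂ ]) S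
M[]-disjointUnion G₁ G₂ S = trans (cong (n G₁ + n G₂ ∸_) (compS-disjointUnion G₁ G₂ S))
                                  (∸-+-distrib (compS≤n G₁ _) (compS≤n G₂ _))

Realisation : ∀ {a} → Matroid a → Set
Realisation {a} M = Σ[ nv ∈ ℕ ] Σ[ ends′ ∈ (Fin a → Fin nv × Fin nv) ] (∀ S → M[ graph nv a ends′ ] S ≡ M S)

realise : ∀ {a} {M : Matroid a} → IsGraphic M → Realisation M
realise {M = M} (G , f , M∘image≡M[G]) = n G , ends G ∘ Inverse.from f , λ S → begin
  n G ∸ compS (relabelEdges G f) S   ≡⟨ cong (n G ∸_) (compS-relabelEdges G f S) ⟨
  M[ G ] (preimage f S)              ≡⟨ M∘image≡M[G] (preimage f S) ⟨
  M (image f (preimage f S))         ≡⟨ cong M (image-preimage f S) ⟩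
  M S                                ∎
  where open ≡-Reasoning

graphic : ∀ {a nv} (ends′ : Fin a → Fin nv × Fin nv) {M : Matroid a} →
          (∀ S → M[ graph nv a ends′ ] S ≡ M S) → IsGraphic M
graphic {a} ends′ {M} M[G]≡M = graph _ a ends′ , ↔-id (Fin a) , λ S →
  trans (cong M (VecP.tabulate∘lookup S)) (sym (M[G]≡M S))

graphic⇒isRank : ∀ {a} (M : Matroid a) → IsGraphic M → IsRank M
graphic⇒isRank M gM = let (nv , ends′ , M[G]≡M) = realise {M = M} gM in IsRank-cong M[G]≡M (M[]-isRank (graph nv _ ends′))

graphic-∖ₘ : ∀ {k} (M : Matroid (suc k)) → IsGraphic M → ∀ e → IsGraphic (M ∖ₘ e)
graphic-∖ₘ M gM e = let (nv , ends′ , M[G]≡M) = realise {M = M} gM in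
  graphic (ends′ ∘ punchIn e) λ S → trans (M[]-deleteEdge ends′ e S) (M[G]≡M (insertAt S e false))

graphic-/ₘ : ∀ {k} (M : Matroid (suc k)) → IsGraphic M → ∀ e → IsGraphic (M /ₘ e)
graphic-/ₘ M gM e = let (nv , ends′ , M[G]≡M) = realise {M = M} gM in
  graphic (ends (contractEdge ends′ e)) λ S →
    trans (M[]-contractEdge ends′ e S) (cong₂ _∸_ (M[G]≡M (insertAt S e true)) (M[G]≡M ⁅ e ⁆))

graphic-⊕ : ∀ {a b} (M : Matroid a) (N : Matroid b) → IsGraphic M → IsGraphic N → IsGraphic (M ⊕ N)
graphic-⊕ {a} M N gM gN = let (n₁ , ends₁ , M[G₁]≡M) = realise {M = M} gM ; (n₂ , ends₂ , M[G₂]≡N) = realise {M = N} gN in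
  graphic (ends (disjointUnion (graph n₁ _ ends₁) (graph n₂ _ ends₂))) λ S →
    trans (M[]-disjointUnion (graph n₁ _ ends₁) (graph n₂ _ ends₂) S)
          (cong₂ _+_ (M[G₁]≡M (Vec.take a S)) (M[G₂]≡N (Vec.drop a S)))

-- Z̃ is a Tutte–Grothendieck invariant

≋-deleteContract : ∀ {Z Z₁ Z₂ D D₁ D₂ q r} → Z ≈ q *P Z₁ +P r *P Z₂ → D ≈ q *P D₁ → D ≈ r *P D₂ →
                   (Z / D) ≋ ((Z₁ / D₁) +F (Z₂ / D₂))
≋-deleteContract {Z} {Z₁} {Z₂} {D} {D₁} {D₂} {q} {r} Z≈ D≈qD₁ D≈rD₂ = begin
  Z *P (D₁ *P D₂)                                  ≈⟨ *P-cong Z≈ ≈-refl ⟩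
  (q *P Z₁ +P r *P Z₂) *P (D₁ *P D₂)               ≈⟨ regroup q r Z₁ Z₂ D₁ D₂ ⟩
  (Z₁ *P D₂) *P (q *P D₁) +P (Z₂ *P D₁) *P (r *P D₂) ≈⟨ +P-cong (*P-congˡ (Z₁ *P D₂) D≈qD₁) (*P-congˡ (Z₂ *P D₁) D≈rD₂) ⟨
  (Z₁ *P D₂) *P D +P (Z₂ *P D₁) *P D               ≈⟨ *P-distribʳ D (Z₁ *P D₂) (Z₂ *P D₁) ⟨
  (Z₁ *P D₂ +P Z₂ *P D₁) *P D                      ∎
  where
  open ≈-Reasoning
  regroup : ∀ q r Z₁ Z₂ D₁ D₂ → (q *P Z₁ +P r *P Z₂) *P (D₁ *P D₂) ≈ (Z₁ *P D₂) *P (q *P D₁) +P (Z₂ *P D₁) *P (r *P D₂)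
  regroup = solve-∀ polyACR

Ψ-deleteContract : ∀ {k} {ρ : Matroid (suc k)} → IsRank ρ → ∀ e → IsLink ρ e → Ψ ρ ≋ (Ψ (ρ ∖ₘ e) +F Ψ (ρ /ₘ e))
Ψ-deleteContract {ρ = ρ} rank e link@(¬loop , ¬coloop) =
  ≋-deleteContract {Zₘ ρ} {Zₘ (ρ ∖ₘ e)} {Zₘ (ρ /ₘ e)} {Dₘ ρ} {Dₘ (ρ ∖ₘ e)} {Dₘ (ρ /ₘ e)} {qP} {1-qP}
    (Zₘ-deleteContract rank e link) (Dₘ-delete rank e ¬coloop) (Dₘ-contract rank e ¬loop)

Ψ-⊕ : ∀ {a b} {ρ₁ : Matroid a} {ρ₂ : Matroid b} → IsRank ρ₁ → IsRank ρ₂ → Ψ (ρ₁ ⊕ ρ₂) ≋ (Ψ ρ₁ *F Ψ ρ₂)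
Ψ-⊕ rank₁ rank₂ = *P-cong (Zₘ-⊕ rank₁ rank₂) (≈-sym (Dₘ-⊕ rank₁ rank₂))

Z̃-invariant : ∀ G H → M[ G ] ≃M M[ H ] → Z̃ G ≈F Z̃ H
Z̃-invariant G H G≃H = toCoeffs (⇝-≋ (Z̃⇝Ψ G) (Z̃⇝Ψ H) (*P-cong (Zₘ-≃ M[ G ] M[ H ] G≃H) (≈-sym (Dₘ-≃ M[ G ] M[ H ] G≃H))))

Z̃-deleteContract : ∀ {k} (M : Matroid (suc k)) e → IsGraphic M → IsLink M e →
                   ∀ G G₁ G₂ → M[ G ] ≃M M → M[ G₁ ] ≃M (M ∖ₘ e) → M[ G₂ ] ≃M (M /ₘ e) → Z̃ G ≈F (Z̃ G₁ +F Z̃ G₂)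
Z̃-deleteContract M e gM link G G₁ G₂ G≃M G₁≃M∖e G₂≃M/e = toCoeffs (⇝-≋
  (Z̃⇝Ψ-≃ G M G≃M) (⇝-+F (Z̃⇝Ψ-≃ G₁ (M ∖ₘ e) G₁≃M∖e) (Z̃⇝Ψ-≃ G₂ (M /ₘ e) G₂≃M/e))
  (Ψ-deleteContract (graphic⇒isRank M gM) e link))

Z̃-⊕ : ∀ {a b} (M : Matroid a) (N : Matroid b) → IsGraphic M → IsGraphic N →
      ∀ G G₁ G₂ → M[ G ] ≃M (M ⊕ N) → M[ G₁ ] ≃M M → M[ G₂ ] ≃M N → Z̃ G ≈F (Z̃ G₁ *F Z̃ G₂)
Z̃-⊕ M N gM gN G G₁ G₂ G≃M⊕N G₁≃M G₂≃N = toCoeffs (⇝-≋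
  (Z̃⇝Ψ-≃ G (M ⊕ N) G≃M⊕N) (⇝-*F (Z̃⇝Ψ-≃ G₁ M G₁≃M) (Z̃⇝Ψ-≃ G₂ N G₂≃N))
  (Ψ-⊕ (graphic⇒isRank M gM) (graphic⇒isRank N gN)))

proposition1p6 :
    -- well-definedness: M(G) ≃ M(H) implies Z̃_G = Z̃_H in ℤ(q,t)
    (∀ (G H : Graph) → M[ G ] ≃M M[ H ] → Z̃ G ≈F Z̃ H)
    -- (β) deletion–contraction for links (the class is minor-closed)
    × (∀ {k : ℕ} (M : Matroid (suc k)) (e : Fin (suc k)) → IsGraphic M →
         IsGraphic (M ∖ₘ e) × IsGraphic (M /ₘ e)
         × (IsLink M e → ∀ (G G₁ G₂ : Graph) → M[ G ] ≃M M → M[ G₁ ] ≃M (M ∖ₘ e) →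
              M[ G₂ ] ≃M (M /ₘ e) → Z̃ G ≈F (Z̃ G₁ +F Z̃ G₂)))
    -- (γ) multiplicativity on direct sums
    × (∀ {a b : ℕ} (M : Matroid a) (N : Matroid b) → IsGraphic M → IsGraphic N →
         IsGraphic (M ⊕ N)
         × (∀ (G G₁ G₂ : Graph) → M[ G ] ≃M (M ⊕ N) → M[ G₁ ] ≃M M → M[ G₂ ] ≃M N →
              Z̃ G ≈F (Z̃ G₁ *F Z̃ G₂)))
proposition1p6 =
    Z̃-invariant
  , (λ M e gM → graphic-∖ₘ M gM e , graphic-/ₘ M gM e , λ link → Z̃-deleteContract M e gM link)
  , (λ M N gM gN → graphic-⊕ M N gM gN , Z̃-⊕ M N gM gN)
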